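{- Let $M$ be a simple matroid of rank $r$ with exactly $3r-3-\delta$ elements, where $0\le\delta\le r-2$. Suppose that every line of $M$ has at most three elements, that all roots of the characteristic polynomial $\chi(M;\lambda)$ are integers, and that $\chi(M;2)=0$. Then $M$ has at least $3r-5-2\delta$ three-element circuits (equivalently, $3$-point lines). Moreover, $M$ has exactly $3r-5-2\delta$ three-element circuits if and only if $\chi(M;\lambda)=(\lambda-1)(\lambda-2)^{\delta+1}(\lambda-3)^{r-2-\delta}$.
   Context: For a matroid $M$ with no loops, $\chi(M;\lambda)=\sum_{X\in L(M)}\mu(\emptyset,X)\lambda^{\mathrm{rank}(M)-\mathrm{rank}(X)}$, where $L(M)$ is the lattice of flats and $\mu$ its Möbius function. A line is a flat of rank $2$. A matroid is simple if it has no loops and no parallel elements. -}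

module Defs where

open import Data.Nat as ℕ using (ℕ; zero; suc; _≤_; _∸_; _+_)
open import Data.Bool using (Bool; true; false; _∧_; _∨_; not; if_then_else_; T)
open import Data.Integer as ℤ using (ℤ; +_; -_)
open import Data.Fin using (Fin)
open import Data.Fin.Subset using (Subset; inside; outside; ⁅_⁆; _∪_; _∩_; _⊆_; ∣_∣; ⊥; ⊤)
open import Data.Fin.Subset.Properties using (_∈?_; _⊆?_)
open import Data.List using (List; []; _∷_; [_]; map; _++_; filter; length; foldr; allFin)
open import Data.Vec using ([]; _∷_)
open import Data.Vec.Properties using (≡-dec)
import Data.Bool.Properties as BoolP
open import Relation.Nullary.Decidable using (⌊_⌋)
open import Relation.Binary.PropositionalEquality using (_≡_; _≢_)

record Matroid (n : ℕ) : Set where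
  field
    rk        : Subset n → ℕ
    rk-card   : ∀ X → rk X ≤ ∣ X ∣
    rk-mono   : ∀ {X Y} → X ⊆ Y → rk X ≤ rk Y
    rk-submod : ∀ X Y → rk (X ∪ Y) ℕ.+ rk (X ∩ Y) ≤ rk X ℕ.+ rk Y

open Matroid public

allᵇ : {A : Set} → (A → Bool) → List A → Bool
allᵇ p = foldr (λ a b → p a ∧ b) true

allSubsets : ∀ n → List (Subset n)
allSubsets zero    = [ [] ]
allSubsets (suc n) = map (inside ∷_) s ++ map (outside ∷_) s
  where s = allSubsets n

module _ {n : ℕ} (M : Matroid n) where

  rank : ℕ
  rank = rk M ⊤

  IsSimple : Set
  IsSimple = (∀ e → rk M ⁅ e ⁆ ≡ 1)
           × (∀ e f → e ≢ f → rk M (⁅ e ⁆ ∪ ⁅ f ⁆) ≡ 2)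
    where open import Data.Product using (_×_)

  isFlatᵇ : Subset n → Bool
  isFlatᵇ X = allᵇ (λ e → ⌊ e ∈? X ⌋ ∨ not (rk M (X ∪ ⁅ e ⁆) ℕ.≡ᵇ rk M X)) (allFin n)

  IsFlat : Subset n → Set
  IsFlat X = T (isFlatᵇ X)

  flats : List (Subset n)
  flats = filter (λ X → T? (isFlatᵇ X)) (allSubsets n)
    where open import Data.Bool.Properties using (T?)

  properSubᵇ : Subset n → Subset n → Bool
  properSubᵇ Y X = ⌊ Y ⊆? X ⌋ ∧ not ⌊ ≡-dec BoolP._≟_ Y X ⌋

  isEmptyᵇ : Subset n → Bool
  isEmptyᵇ X = ⌊ ≡-dec BoolP._≟_ X ⊥ ⌋

  sumℤ : List ℤ → ℤ
  sumℤ = foldr ℤ._+_ (+ 0)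

  -- Möbius function μ(∅, X) of the lattice of flats (∅ is its bottom since
  -- M will be loopless):  μ(∅,∅) = 1,  μ(∅,X) = - Σ_{flats Y ⊊ X} μ(∅,Y).
  -- Computed with fuel; fuel n+1 suffices since |Y| < |X| ≤ n along chains.
  mobF : ℕ → Subset n → ℤ
  mobF zero    X = + 1
  mobF (suc k) X = if isEmptyᵇ X then + 1
    else - sumℤ (map (mobF k) (filter (λ Y → T? (properSubᵇ Y X)) flats))
    where open import Data.Bool.Properties using (T?)

  μ : Subset n → ℤ
  μ X = mobF (suc n) X

  χ : ℤ → ℤ
  χ x = sumℤ (map (λ X → μ X ℤ.* (x ℤ.^ (rank ∸ rk M X))) flats)

  isCircuitᵇ : Subset n → Bool
  isCircuitᵇ C = not (rk M C ℕ.≡ᵇ ∣ C ∣)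
    ∧ allᵇ (λ D → not (properSubᵇ D C) ∨ (rk M D ℕ.≡ᵇ ∣ D ∣)) (allSubsets n)

  numThreeCircuits : ℕ
  numThreeCircuits =
    length (filter (λ C → T? ((∣ C ∣ ℕ.≡ᵇ 3) ∧ isCircuitᵇ C)) (allSubsets n))
    where open import Data.Bool.Properties using (T?)

prodLin : List ℤ → ℤ → ℤ
prodLin as x = foldr (λ a p → (x ℤ.- a) ℤ.* p) (+ 1) as

module Submission where

-- By Whitney's formula χ is monic of degree r, its next coefficient is -n
-- (points have μ = -1) and the one after is Σ_lines μ(L) = C(n,2) - t, as
-- μ(L) = |L| - 1 = C(|L|,2) - [|L| = 3] and two points span a unique line.
-- Also χ(1) = 0.  By Vieta the roots have e₁ = n and e₂ = C(n,2) - t; after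
-- removing the roots 1 and 2 the remaining roots b satisfy
-- Σ (b - 2)(b - 3) = 2(t - (3r - 5 - 2δ)), which is ≥ 0 as no integer lies
-- strictly between 2 and 3, and is 0 iff every b is 2 or 3.

open import Defs
open import Data.Nat using (ℕ)
import Data.Nat as ℕ

module Polynomial where

  open import Data.Nat as ℕ using (ℕ; zero; suc; _≤_; s≤s; _∸_)
  import Data.Nat.Properties as ℕP
  open import Data.Integer using (ℤ; +_; -_; _+_; _*_; _-_; _^_; 0ℤ; 1ℤ; ∣_∣)
  import Data.Integer.Properties as ℤP
  open import Data.List using (List; []; _∷_; length; foldr; map)
  open import Data.Bool using (if_then_else_)
  open import Data.Product using (_×_; _,_)
  open import Data.Sum using (inj₁; inj₂)
  open import Data.Empty using (⊥-elim)
  open import Relation.Nullary using (¬_)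
  open import Relation.Binary.PropositionalEquality
  open import Relation.Binary.Definitions using (tri<; tri≈; tri>)
  open import Data.Integer.Tactic.RingSolver using (solve-∀)
  open ≡-Reasoning

  -- Polynomials with integer coefficients, as coefficient lists
  -- (constant term first).
  Poly : Set
  Poly = List ℤ

  eval : Poly → ℤ → ℤ
  eval []      x = 0ℤ
  eval (c ∷ p) x = c + x * eval p x

  coeff : Poly → ℕ → ℤ
  coeff []      k       = 0ℤ
  coeff (c ∷ p) zero    = c
  coeff (c ∷ p) (suc k) = coeff p k

  infixl 6 _⊕_
  infixr 7 _⊛_

  _⊕_ : Poly → Poly → Poly
  []      ⊕ q       = q
  (a ∷ p) ⊕ []      = a ∷ p
  (a ∷ p) ⊕ (b ∷ q) = (a + b) ∷ (p ⊕ q)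

  _⊛_ : ℤ → Poly → Poly
  a ⊛ p = map (a *_) p

  eval-⊕ : ∀ p q x → eval (p ⊕ q) x ≡ eval p x + eval q x
  eval-⊕ []      q       x = sym (ℤP.+-identityˡ _)
  eval-⊕ (a ∷ p) []      x = sym (ℤP.+-identityʳ _)
  eval-⊕ (a ∷ p) (b ∷ q) x rewrite eval-⊕ p q x = shuffle a b x (eval p x) (eval q x)
    where
    shuffle : ∀ (a b x u v : ℤ) → a + b + x * (u + v) ≡ a + x * u + (b + x * v)
    shuffle = solve-∀

  coeff-⊕ : ∀ p q k → coeff (p ⊕ q) k ≡ coeff p k + coeff q k
  coeff-⊕ []      q       k       = sym (ℤP.+-identityˡ _)
  coeff-⊕ (a ∷ p) []      zero    = sym (ℤP.+-identityʳ _)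
  coeff-⊕ (a ∷ p) []      (suc k) = sym (ℤP.+-identityʳ _)
  coeff-⊕ (a ∷ p) (b ∷ q) zero    = refl
  coeff-⊕ (a ∷ p) (b ∷ q) (suc k) = coeff-⊕ p q k

  eval-⊛ : ∀ a p x → eval (a ⊛ p) x ≡ a * eval p x
  eval-⊛ a []      x = sym (ℤP.*-zeroʳ a)
  eval-⊛ a (c ∷ p) x rewrite eval-⊛ a p x = shuffle a c x (eval p x)
    where
    shuffle : ∀ (a c x u : ℤ) → a * c + x * (a * u) ≡ a * (c + x * u)
    shuffle = solve-∀

  coeff-⊛ : ∀ a p k → coeff (a ⊛ p) k ≡ a * coeff p k
  coeff-⊛ a []      k       = sym (ℤP.*-zeroʳ a)
  coeff-⊛ a (c ∷ p) zero    = refl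
  coeff-⊛ a (c ∷ p) (suc k) = coeff-⊛ a p k

  -- If c + (1 + |c|)·e = 0 then e = 0, since otherwise |c| = (1 + |c|)·|e| > |c|.
  -- This is why evaluating at 1 + |c| detects a nonzero constant term c.
  small-multiple : ∀ c e → c + (+ suc ∣ c ∣) * e ≡ 0ℤ → e ≡ 0ℤ
  small-multiple c e h = ℤP.∣i∣≡0⇒i≡0 (only-zero ∣ e ∣ ∣c∣≡)
    where
    m = + suc ∣ c ∣
    c≡-me : c ≡ - (m * e)
    c≡-me = begin
      c                   ≡⟨ cancel c (m * e) ⟩
      c + m * e - m * e   ≡⟨ cong (_- m * e) h ⟩
      0ℤ - m * e          ≡⟨ ℤP.+-identityˡ _ ⟩
      - (m * e)           ∎
      where
      cancel : ∀ (a b : ℤ) → a ≡ a + b - b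
      cancel = solve-∀
    ∣c∣≡ : ∣ c ∣ ≡ suc ∣ c ∣ ℕ.* ∣ e ∣
    ∣c∣≡ = begin
      ∣ c ∣                 ≡⟨ cong ∣_∣ c≡-me ⟩
      ∣ - (m * e) ∣         ≡⟨ ℤP.∣-i∣≡∣i∣ (m * e) ⟩
      ∣ m * e ∣             ≡⟨ ℤP.abs-* m e ⟩
      suc ∣ c ∣ ℕ.* ∣ e ∣   ∎
    only-zero : ∀ k → ∣ c ∣ ≡ suc ∣ c ∣ ℕ.* k → k ≡ 0
    only-zero zero    _  = refl
    only-zero (suc k) eq = ⊥-elim (ℕP.<-irrefl refl
      (ℕP.≤-trans (ℕP.m≤m*n (suc ∣ c ∣) (suc k)) (ℕP.≤-reflexive (sym eq))))

  -- A polynomial vanishing at every nonzero integer has only zero coefficients: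
  -- evaluating at 1 + |c| kills the constant term c, and then x·p(x) = 0
  -- for x ≠ 0 lets us recurse on the remaining coefficients.
  vanishing⇒zero : ∀ p → (∀ x → ¬ x ≡ 0ℤ → eval p x ≡ 0ℤ) → ∀ k → coeff p k ≡ 0ℤ
  vanishing⇒zero []      h k       = refl
  vanishing⇒zero (c ∷ p) h zero    = begin
    c                         ≡⟨ sym (ℤP.+-identityʳ c) ⟩
    c + 0ℤ                    ≡⟨ cong (_+_ c) (sym (ℤP.*-zeroʳ x₀)) ⟩
    c + x₀ * 0ℤ               ≡⟨ cong (λ u → c + x₀ * u) (sym p[x₀]≡0) ⟩
    c + x₀ * eval p x₀        ≡⟨ h x₀ (λ ()) ⟩
    0ℤ                        ∎
    where
    x₀ = + suc ∣ c ∣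
    p[x₀]≡0 : eval p x₀ ≡ 0ℤ
    p[x₀]≡0 = small-multiple c (eval p x₀) (h x₀ (λ ()))
  vanishing⇒zero (c ∷ p) h (suc k) = vanishing⇒zero p tail-vanishes k
    where
    c≡0 : c ≡ 0ℤ
    c≡0 = vanishing⇒zero (c ∷ p) h zero
    tail-vanishes : ∀ x → ¬ x ≡ 0ℤ → eval p x ≡ 0ℤ
    tail-vanishes x x≢0 with ℤP.i*j≡0⇒i≡0∨j≡0 x x*p[x]≡0
      where
      x*p[x]≡0 : x * eval p x ≡ 0ℤ
      x*p[x]≡0 = begin
        x * eval p x        ≡⟨ sym (ℤP.+-identityˡ _) ⟩
        0ℤ + x * eval p x   ≡⟨ cong (λ u → u + x * eval p x) (sym c≡0) ⟩
        c + x * eval p x    ≡⟨ h x x≢0 ⟩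
        0ℤ                  ∎
    ... | inj₁ x≡0 = ⊥-elim (x≢0 x≡0)
    ... | inj₂ p[x]≡0 = p[x]≡0

  coeff-unique : ∀ p q → (∀ x → eval p x ≡ eval q x) → ∀ k → coeff p k ≡ coeff q k
  coeff-unique p q h k = ℤP.i-j≡0⇒i≡j (coeff p k) (coeff q k) (begin
      coeff p k - coeff q k         ≡⟨ sym (minus-one (coeff p k) (coeff q k)) ⟩
      coeff p k + - 1ℤ * coeff q k  ≡⟨ sym (coeff-difference k) ⟩
      coeff (p ⊕ (- 1ℤ ⊛ q)) k      ≡⟨ vanishing⇒zero (p ⊕ (- 1ℤ ⊛ q)) (λ x _ → difference-vanishes x) k ⟩
      0ℤ                            ∎)
    where
    minus-one : ∀ (a b : ℤ) → a + - 1ℤ * b ≡ a - b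
    minus-one = solve-∀
    coeff-difference : ∀ k → coeff (p ⊕ (- 1ℤ ⊛ q)) k ≡ coeff p k + - 1ℤ * coeff q k
    coeff-difference k = trans (coeff-⊕ p (- 1ℤ ⊛ q) k) (cong (_+_ (coeff p k)) (coeff-⊛ (- 1ℤ) q k))
    difference-vanishes : ∀ x → eval (p ⊕ (- 1ℤ ⊛ q)) x ≡ 0ℤ
    difference-vanishes x = begin
      eval (p ⊕ (- 1ℤ ⊛ q)) x         ≡⟨ eval-⊕ p (- 1ℤ ⊛ q) x ⟩
      eval p x + eval (- 1ℤ ⊛ q) x    ≡⟨ cong (_+_ (eval p x)) (eval-⊛ (- 1ℤ) q x) ⟩
      eval p x + - 1ℤ * eval q x      ≡⟨ minus-one (eval p x) (eval q x) ⟩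
      eval p x - eval q x             ≡⟨ ℤP.i≡j⇒i-j≡0 (h x) ⟩
      0ℤ                              ∎

  -- The finite sum of integers (agrees definitionally with the sums in Defs).
  Σℤ : List ℤ → ℤ
  Σℤ = foldr _+_ 0ℤ

  monomial : ℤ → ℕ → Poly
  monomial c zero    = c ∷ []
  monomial c (suc d) = 0ℤ ∷ monomial c d

  eval-monomial : ∀ c d x → eval (monomial c d) x ≡ c * x ^ d
  eval-monomial c zero x = constant c x
    where
    constant : ∀ (c x : ℤ) → c + x * 0ℤ ≡ c * 1ℤ
    constant = solve-∀
  eval-monomial c (suc d) x rewrite eval-monomial c d x = shift c x (x ^ d)
    where
    shift : ∀ (c x u : ℤ) → 0ℤ + x * (c * u) ≡ c * (x * u)
    shift = solve-∀

  coeff-monomial : ∀ c d k → coeff (monomial c d) k ≡ (if k ℕ.≡ᵇ d then c else 0ℤ)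
  coeff-monomial c zero    zero    = refl
  coeff-monomial c zero    (suc k) = refl
  coeff-monomial c (suc d) zero    = refl
  coeff-monomial c (suc d) (suc k) = coeff-monomial c d k

  module _ {A : Set} (f : A → Poly) where

    ⨁ : List A → Poly
    ⨁ []       = []
    ⨁ (a ∷ as) = f a ⊕ ⨁ as

    eval-⨁ : ∀ as x → eval (⨁ as) x ≡ Σℤ (map (λ a → eval (f a) x) as)
    eval-⨁ []       x = refl
    eval-⨁ (a ∷ as) x = trans (eval-⊕ (f a) (⨁ as) x) (cong (_+_ (eval (f a) x)) (eval-⨁ as x))

    coeff-⨁ : ∀ as k → coeff (⨁ as) k ≡ Σℤ (map (λ a → coeff (f a) k) as)
    coeff-⨁ []       k = refl
    coeff-⨁ (a ∷ as) k = trans (coeff-⊕ (f a) (⨁ as) k) (cong (_+_ (coeff (f a) k)) (coeff-⨁ as k))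

  _·linear_ : Poly → ℤ → Poly
  p ·linear a = (0ℤ ∷ p) ⊕ (- a ⊛ p)

  prodPoly : List ℤ → Poly
  prodPoly []       = 1ℤ ∷ []
  prodPoly (a ∷ as) = prodPoly as ·linear a

  coeff-·linear : ∀ a p k → coeff (p ·linear a) (suc k) ≡ coeff p k + - a * coeff p (suc k)
  coeff-·linear a p k = trans (coeff-⊕ (0ℤ ∷ p) (- a ⊛ p) (suc k))
                              (cong (_+_ (coeff p k)) (coeff-⊛ (- a) p (suc k)))

  coeff₀-·linear : ∀ a p → coeff (p ·linear a) zero ≡ - a * coeff p zero
  coeff₀-·linear a p = trans (coeff-⊕ (0ℤ ∷ p) (- a ⊛ p) zero)
                             (trans (cong (_+_ 0ℤ) (coeff-⊛ (- a) p zero)) (ℤP.+-identityˡ _))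

  eval-prodPoly : ∀ as x → eval (prodPoly as) x ≡ prodLin as x
  eval-prodPoly []       x = one x
    where
    one : ∀ (x : ℤ) → 1ℤ + x * 0ℤ ≡ 1ℤ
    one = solve-∀
  eval-prodPoly (a ∷ as) x = begin
    eval (p ·linear a) x
      ≡⟨ eval-⊕ (0ℤ ∷ p) (- a ⊛ p) x ⟩
    0ℤ + x * eval p x + eval (- a ⊛ p) x
      ≡⟨ cong (_+_ (0ℤ + x * eval p x)) (eval-⊛ (- a) p x) ⟩
    0ℤ + x * eval p x + - a * eval p x
      ≡⟨ factor a x (eval p x) ⟩
    (x - a) * eval p x
      ≡⟨ cong ((x - a) *_) (eval-prodPoly as x) ⟩
    (x - a) * prodLin as x ∎
    where
    p = prodPoly as
    factor : ∀ (a x u : ℤ) → 0ℤ + x * u + - a * u ≡ (x - a) * u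
    factor = solve-∀

  prodPoly-above : ∀ as j → coeff (prodPoly as) (suc (length as ℕ.+ j)) ≡ 0ℤ
  prodPoly-above []       j = refl
  prodPoly-above (a ∷ as) j = begin
    coeff (prodPoly (a ∷ as)) (suc (suc (length as ℕ.+ j)))
      ≡⟨ coeff-·linear a (prodPoly as) _ ⟩
    coeff (prodPoly as) (suc (length as ℕ.+ j)) + - a * coeff (prodPoly as) (suc (suc (length as ℕ.+ j)))
      ≡⟨ cong₂ (λ u v → u + - a * v) (prodPoly-above as j) shifted ⟩
    0ℤ + - a * 0ℤ
      ≡⟨ vanish a ⟩
    0ℤ ∎
    where
    shifted : coeff (prodPoly as) (suc (suc (length as ℕ.+ j))) ≡ 0ℤ
    shifted = trans (cong (λ m → coeff (prodPoly as) (suc m)) (sym (ℕP.+-suc (length as) j)))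
                    (prodPoly-above as (suc j))
    vanish : ∀ (a : ℤ) → 0ℤ + - a * 0ℤ ≡ 0ℤ
    vanish = solve-∀

  prodPoly-top : ∀ as → coeff (prodPoly as) (length as) ≡ 1ℤ
  prodPoly-top []       = refl
  prodPoly-top (a ∷ as) = begin
    coeff (prodPoly (a ∷ as)) (suc (length as))
      ≡⟨ coeff-·linear a (prodPoly as) _ ⟩
    coeff (prodPoly as) (length as) + - a * coeff (prodPoly as) (suc (length as))
      ≡⟨ cong₂ (λ u v → u + - a * v) (prodPoly-top as) next ⟩
    1ℤ + - a * 0ℤ
      ≡⟨ leading a ⟩
    1ℤ ∎
    where
    next : coeff (prodPoly as) (suc (length as)) ≡ 0ℤ
    next = trans (cong (λ m → coeff (prodPoly as) (suc m)) (sym (ℕP.+-identityʳ (length as))))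
                 (prodPoly-above as 0)
    leading : ∀ (a : ℤ) → 1ℤ + - a * 0ℤ ≡ 1ℤ
    leading = solve-∀

  prodPoly-e₁ : ∀ a as → coeff (prodPoly (a ∷ as)) (length as) ≡ - Σℤ (a ∷ as)
  prodPoly-e₁ a []       = trans (coeff₀-·linear a (1ℤ ∷ [])) (base a)
    where
    base : ∀ (a : ℤ) → - a * 1ℤ ≡ - (a + 0ℤ)
    base = solve-∀
  prodPoly-e₁ a (b ∷ as) = begin
    coeff (prodPoly (a ∷ b ∷ as)) (suc (length as))
      ≡⟨ coeff-·linear a (prodPoly (b ∷ as)) _ ⟩
    coeff (prodPoly (b ∷ as)) (length as) + - a * coeff (prodPoly (b ∷ as)) (length (b ∷ as))
      ≡⟨ cong₂ (λ u v → u + - a * v) (prodPoly-e₁ b as) (prodPoly-top (b ∷ as)) ⟩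
    - (b + Σℤ as) + - a * 1ℤ
      ≡⟨ step a b (Σℤ as) ⟩
    - Σℤ (a ∷ b ∷ as) ∎
    where
    step : ∀ (a b s : ℤ) → - (b + s) + - a * 1ℤ ≡ - (a + (b + s))
    step = solve-∀

  e₂ : List ℤ → ℤ
  e₂ []       = 0ℤ
  e₂ (a ∷ as) = a * Σℤ as + e₂ as

  prodPoly-e₂ : ∀ a b as → coeff (prodPoly (a ∷ b ∷ as)) (length as) ≡ e₂ (a ∷ b ∷ as)
  prodPoly-e₂ a b []       = begin
    coeff (prodPoly (a ∷ b ∷ [])) 0    ≡⟨ coeff₀-·linear a (prodPoly (b ∷ [])) ⟩
    - a * coeff (prodPoly (b ∷ [])) 0  ≡⟨ cong (- a *_) (prodPoly-e₁ b []) ⟩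
    - a * - (b + 0ℤ)                   ≡⟨ base a b ⟩
    e₂ (a ∷ b ∷ [])                    ∎
    where
    base : ∀ (a b : ℤ) → - a * - (b + 0ℤ) ≡ a * (b + 0ℤ) + (b * 0ℤ + 0ℤ)
    base = solve-∀
  prodPoly-e₂ a b (c ∷ as) = begin
    coeff (prodPoly (a ∷ b ∷ c ∷ as)) (suc (length as))
      ≡⟨ coeff-·linear a (prodPoly (b ∷ c ∷ as)) _ ⟩
    coeff (prodPoly (b ∷ c ∷ as)) (length as) + - a * coeff (prodPoly (b ∷ c ∷ as)) (length (c ∷ as))
      ≡⟨ cong₂ (λ u v → u + - a * v) (prodPoly-e₂ b c as) (prodPoly-e₁ b (c ∷ as)) ⟩
    e₂ (b ∷ c ∷ as) + - a * - Σℤ (b ∷ c ∷ as)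
      ≡⟨ step a b c (Σℤ as) (e₂ as) ⟩
    e₂ (a ∷ b ∷ c ∷ as) ∎
    where
    step : ∀ (a b c s e : ℤ) → b * (c + s) + (c * s + e) + - a * - (b + (c + s))
                             ≡ a * (b + (c + s)) + (b * (c + s) + (c * s + e))
    step = solve-∀

  subleading : ∀ p as → (∀ k → coeff p k ≡ coeff (prodPoly as) k) → 2 ≤ length as
             → coeff p (length as ∸ 1) ≡ - Σℤ as × coeff p (length as ∸ 2) ≡ e₂ as
  subleading p (a ∷ b ∷ as) same _ = trans (same _) (prodPoly-e₁ a (b ∷ as))
                                   , trans (same _) (prodPoly-e₂ a b as)
  subleading p (a ∷ []) same (s≤s ())

  record Monic (p : Poly) (d : ℕ) : Set where
    field
      leading : coeff p d ≡ 1ℤ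
      above   : ∀ j → coeff p (suc (d ℕ.+ j)) ≡ 0ℤ

  vieta : ∀ p d as → 2 ≤ d → Monic p d → (∀ x → eval p x ≡ prodLin as x)
        → length as ≡ d × coeff p (d ∸ 1) ≡ - Σℤ as × coeff p (d ∸ 2) ≡ e₂ as
  vieta p d as 2≤d monic factorization =
    length≡d , subst (λ m → coeff p (m ∸ 1) ≡ - Σℤ as × coeff p (m ∸ 2) ≡ e₂ as) length≡d
                     (subleading p as same-coeffs (subst (2 ≤_) (sym length≡d) 2≤d))
    where
    open Monic monic
    same-coeffs : ∀ k → coeff p k ≡ coeff (prodPoly as) k
    same-coeffs = coeff-unique p (prodPoly as)
      (λ x → trans (factorization x) (sym (eval-prodPoly as x)))

    1≢0 : ¬ 1ℤ ≡ 0ℤ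
    1≢0 ()

    length≡d : length as ≡ d
    length≡d with ℕP.<-cmp (length as) d
    ... | tri≈ _ eq _ = eq
    ... | tri< |as|<d _ _ = ⊥-elim (1≢0 (begin
      1ℤ                                          ≡⟨ sym leading ⟩
      coeff p d                                   ≡⟨ same-coeffs d ⟩
      coeff (prodPoly as) d                       ≡⟨ cong (coeff (prodPoly as)) (sym (ℕP.m+[n∸m]≡n |as|<d)) ⟩
      coeff (prodPoly as) (suc (length as) ℕ.+ (d ∸ suc (length as)))
                                                  ≡⟨ prodPoly-above as _ ⟩
      0ℤ                                          ∎))
    ... | tri> _ _ d<|as| = ⊥-elim (1≢0 (begin
      1ℤ                                          ≡⟨ sym (prodPoly-top as) ⟩
      coeff (prodPoly as) (length as)             ≡⟨ sym (same-coeffs (length as)) ⟩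
      coeff p (length as)                         ≡⟨ cong (coeff p) (sym (ℕP.m+[n∸m]≡n d<|as|)) ⟩
      coeff p (suc d ℕ.+ (length as ∸ suc d))     ≡⟨ above _ ⟩
      0ℤ                                          ∎))

module RootArithmetic where

  open import Data.Nat as ℕ using (ℕ; zero; suc; _∸_)
  open import Data.Nat.Combinatorics using (_C_; nC1≡n; nCk+nC[k+1]≡[n+1]C[k+1])
  import Data.Nat.Properties as ℕP
  open import Data.Integer using (ℤ; +_; -[1+_]; -_; _+_; _*_; _-_; _^_; 0ℤ; 1ℤ; _≤_; +≤+)
  import Data.Integer.Properties as ℤP
  open import Data.List using (List; []; _∷_; length; map; _++_; replicate)
  import Data.List.Relation.Unary.All.Properties as AllP
  open import Data.List.Relation.Unary.Any using (here; there)
  open import Data.List.Relation.Unary.All using (All; []; _∷_)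
  open import Data.List.Membership.Propositional using (_∈_)
  open import Data.Product using (Σ; ∃; _×_; _,_; proj₁; proj₂)
  open import Data.Sum using (_⊎_; inj₁; inj₂)
  open import Data.Empty using (⊥-elim)
  open import Relation.Nullary using (¬_)
  open import Function.Bundles using (_⇔_; mk⇔; Equivalence)
  open import Relation.Binary.PropositionalEquality
  open import Data.Integer.Tactic.RingSolver using (solve-∀)
  import Data.Nat.Tactic.RingSolver as ℕ-Solver
  open ≡-Reasoning
  open Polynomial using (Σℤ; e₂)

  difference-zero : ∀ y a → y - a ≡ 0ℤ → y ≡ a
  difference-zero y a = ℤP.i-j≡0⇒i≡j y a

  root∈ : ∀ as y → prodLin as y ≡ 0ℤ → y ∈ as
  root∈ []       y ()
  root∈ (a ∷ as) y h with ℤP.i*j≡0⇒i≡0∨j≡0 (y - a) h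
  ... | inj₁ y-a≡0 = here (difference-zero y a y-a≡0)
  ... | inj₂ rest≡0 = there (root∈ as y rest≡0)

  split-root : ∀ as y → y ∈ as → Σ (List ℤ) λ rest →
    (∀ x → prodLin as x ≡ (x - y) * prodLin rest x) × (∀ z → z ∈ as → ¬ z ≡ y → z ∈ rest)
  split-root (a ∷ as) y (here refl) = as , (λ x → refl) , survivors
    where
    survivors : ∀ z → z ∈ (y ∷ as) → ¬ z ≡ y → z ∈ as
    survivors z (here z≡y) z≢y = ⊥-elim (z≢y z≡y)
    survivors z (there z∈as) _ = z∈as
  split-root (a ∷ as) y (there y∈as) with split-root as y y∈as
  ... | rest , factored , kept = (a ∷ rest) , factored′ , survivors
    where
    factored′ : ∀ x → prodLin (a ∷ as) x ≡ (x - y) * prodLin (a ∷ rest) x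
    factored′ x = begin
      (x - a) * prodLin as x                ≡⟨ cong ((x - a) *_) (factored x) ⟩
      (x - a) * ((x - y) * prodLin rest x)  ≡⟨ swap (x - a) (x - y) (prodLin rest x) ⟩
      (x - y) * ((x - a) * prodLin rest x)  ∎
      where
      swap : ∀ (u v w : ℤ) → u * (v * w) ≡ v * (u * w)
      swap = solve-∀
    survivors : ∀ z → z ∈ (a ∷ as) → ¬ z ≡ y → z ∈ (a ∷ rest)
    survivors z (here z≡a)  _   = here z≡a
    survivors z (there z∈as) z≢y = there (kept z z∈as z≢y)

  split-1-2 : ∀ as → prodLin as (+ 1) ≡ 0ℤ → prodLin as (+ 2) ≡ 0ℤ
            → Σ (List ℤ) λ bs → ∀ x → prodLin as x ≡ prodLin (+ 2 ∷ + 1 ∷ bs) x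
  split-1-2 as root1 root2 with split-root as (+ 2) (root∈ as (+ 2) root2)
  ... | rest , factored , kept with split-root rest (+ 1) (kept (+ 1) (root∈ as (+ 1) root1) (λ ()))
  ...   | bs , factored′ , _ = bs , λ x → trans (factored x) (cong ((x - + 2) *_) (factored′ x))

  q : ℤ → ℤ
  q b = (b - + 2) * (b - + 3)

  Q : List ℤ → ℤ
  Q bs = Σℤ (map q bs)

  -- (d + 1)·d ≥ 0: consecutive integers never have strictly opposite signs.
  consecutive-product : ∀ d → 0ℤ ≤ (d + 1ℤ) * d
  consecutive-product (+ zero)      = +≤+ ℕ.z≤n
  consecutive-product (+ suc j)     = +≤+ ℕ.z≤n
  consecutive-product -[1+ zero ]   = +≤+ ℕ.z≤n
  consecutive-product -[1+ suc j ]  = +≤+ ℕ.z≤n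

  q-nonneg : ∀ b → 0ℤ ≤ q b
  q-nonneg b = subst (0ℤ ≤_) (shift b) (consecutive-product (b - + 3))
    where
    shift : ∀ (b : ℤ) → ((b - + 3) + 1ℤ) * (b - + 3) ≡ (b - + 2) * (b - + 3)
    shift = solve-∀

  TwoOrThree : ℤ → Set
  TwoOrThree b = b ≡ + 2 ⊎ b ≡ + 3

  q-zero : ∀ b → q b ≡ 0ℤ → TwoOrThree b
  q-zero b h with ℤP.i*j≡0⇒i≡0∨j≡0 (b - + 2) h
  ... | inj₁ b-2≡0 = inj₁ (difference-zero b (+ 2) b-2≡0)
  ... | inj₂ b-3≡0 = inj₂ (difference-zero b (+ 3) b-3≡0)

  nonneg-sum-zero : ∀ x y → 0ℤ ≤ x → 0ℤ ≤ y → x + y ≡ 0ℤ → x ≡ 0ℤ × y ≡ 0ℤ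
  nonneg-sum-zero (+ zero)  (+ zero)  _ _ _  = refl , refl
  nonneg-sum-zero (+ zero)  (+ suc b) _ _ ()
  nonneg-sum-zero (+ suc a) (+ b)     _ _ ()

  Q-nonneg : ∀ bs → 0ℤ ≤ Q bs
  Q-nonneg []       = +≤+ ℕ.z≤n
  Q-nonneg (b ∷ bs) = ℤP.+-mono-≤ (q-nonneg b) (Q-nonneg bs)

  Q≡0⇒two-three : ∀ bs → Q bs ≡ 0ℤ → All TwoOrThree bs
  Q≡0⇒two-three []       h = []
  Q≡0⇒two-three (b ∷ bs) h with nonneg-sum-zero (q b) (Q bs) (q-nonneg b) (Q-nonneg bs) h
  ... | qb≡0 , Qbs≡0 = q-zero b qb≡0 ∷ Q≡0⇒two-three bs Qbs≡0

  two-three⇒Q≡0 : ∀ bs → All TwoOrThree bs → Q bs ≡ 0ℤ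
  two-three⇒Q≡0 []       []                = refl
  two-three⇒Q≡0 (b ∷ bs) (inj₁ refl ∷ all) = trans (ℤP.+-identityˡ (Q bs)) (two-three⇒Q≡0 bs all)
  two-three⇒Q≡0 (b ∷ bs) (inj₂ refl ∷ all) = trans (ℤP.+-identityˡ (Q bs)) (two-three⇒Q≡0 bs all)

  Q-expand : ∀ bs → Q bs ≡ Σℤ bs * Σℤ bs - + 2 * e₂ bs - + 5 * Σℤ bs + + 6 * + length bs
  Q-expand []       = refl
  Q-expand (b ∷ bs) = begin
    q b + Q bs
      ≡⟨ cong (_+_ (q b)) (Q-expand bs) ⟩
    q b + (s * s - + 2 * e - + 5 * s + + 6 * + length bs)
      ≡⟨ regroup b s e (+ length bs) ⟩
    (b + s) * (b + s) - + 2 * (b * s + e) - + 5 * (b + s) + + 6 * (+ 1 + + length bs)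
      ≡⟨ cong (λ L → (b + s) * (b + s) - + 2 * (b * s + e) - + 5 * (b + s) + + 6 * L)
              (sym (ℤP.pos-+ 1 (length bs))) ⟩
    (b + s) * (b + s) - + 2 * (b * s + e) - + 5 * (b + s) + + 6 * + length (b ∷ bs) ∎
    where
    s = Σℤ bs
    e = e₂ bs
    regroup : ∀ (b s e L : ℤ) →
      (b - + 2) * (b - + 3) + (s * s - + 2 * e - + 5 * s + + 6 * L)
        ≡ (b + s) * (b + s) - + 2 * (b * s + e) - + 5 * (b + s) + + 6 * (+ 1 + L)
    regroup = solve-∀

  -- Suppose the roots are 2, 1 and bs,
  -- with s = Σ bs, e = e₂ bs, L = |bs|, and that the roots have sum N,
  -- second elementary symmetric function B - t, where 2B + N = N²,
  -- and N + D + 3 = 3R for R = 2 + L.  Then Q(bs) + 6R = 2(5 + 2D + t).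
  quadratic-identity : ∀ (s e L N B t R D : ℤ)
    → + 2 + (+ 1 + s) ≡ N
    → + 2 * (+ 1 + s) + (+ 1 * s + e) ≡ B - t
    → B * + 2 + N ≡ N * N
    → N + D + + 3 ≡ + 3 * R
    → + 2 + L ≡ R
    → s * s - + 2 * e - + 5 * s + + 6 * L + + 6 * R ≡ + 2 * (+ 5 + + 2 * D + t)
  quadratic-identity s e L _ B t _ D refl e₂-roots B-double N+D+3 refl = begin
    s * s - + 2 * e - + 5 * s + + 6 * L + + 6 * R
      ≡⟨ isolate-e₂ s e L ⟩
    P - + 2 * (+ 2 * (+ 1 + s) + (+ 1 * s + e))
      ≡⟨ cong (λ u → P - + 2 * u) e₂-roots ⟩
    P - + 2 * (B - t)
      ≡⟨ isolate-B s L B t ⟩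
    P + + 2 * t + N - (B * + 2 + N)
      ≡⟨ cong (λ u → P + + 2 * t + N - u) B-double ⟩
    P + + 2 * t + N - N * N
      ≡⟨ eliminate-s s L t ⟩
    + 2 * (+ 5 + + 2 * (+ 3 * R - N - + 3) + t)
      ≡⟨ cong (λ u → + 2 * (+ 5 + + 2 * u + t)) D≡ ⟩
    + 2 * (+ 5 + + 2 * D + t) ∎
    where
    N = + 2 + (+ 1 + s)
    R = + 2 + L
    P = s * s + s + + 16 + + 12 * L
    isolate-e₂ : ∀ (s e L : ℤ) → s * s - + 2 * e - + 5 * s + + 6 * L + + 6 * (+ 2 + L)
                 ≡ (s * s + s + + 16 + + 12 * L) - + 2 * (+ 2 * (+ 1 + s) + (+ 1 * s + e))
    isolate-e₂ = solve-∀
    isolate-B : ∀ (s L B t : ℤ) → (s * s + s + + 16 + + 12 * L) - + 2 * (B - t)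
                ≡ (s * s + s + + 16 + + 12 * L) + + 2 * t + (+ 2 + (+ 1 + s)) - (B * + 2 + (+ 2 + (+ 1 + s)))
    isolate-B = solve-∀
    eliminate-s : ∀ (s L t : ℤ)
      → (s * s + s + + 16 + + 12 * L) + + 2 * t + (+ 2 + (+ 1 + s)) - (+ 2 + (+ 1 + s)) * (+ 2 + (+ 1 + s))
        ≡ + 2 * (+ 5 + + 2 * (+ 3 * (+ 2 + L) - (+ 2 + (+ 1 + s)) - + 3) + t)
    eliminate-s = solve-∀
    D≡ : + 3 * R - N - + 3 ≡ D
    D≡ = begin
      + 3 * R - N - + 3      ≡⟨ cong (λ u → u - N - + 3) (sym N+D+3) ⟩
      N + D + + 3 - N - + 3  ≡⟨ cancel N D ⟩
      D                      ∎
      where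
      cancel : ∀ (N D : ℤ) → N + D + + 3 - N - + 3 ≡ D
      cancel = solve-∀

  choose-2 : ∀ n → (n C 2) ℕ.* 2 ℕ.+ n ≡ n ℕ.* n
  choose-2 zero    = refl
  choose-2 (suc n) = begin
    (suc n C 2) ℕ.* 2 ℕ.+ suc n
      ≡⟨ cong (λ c → c ℕ.* 2 ℕ.+ suc n) (sym (nCk+nC[k+1]≡[n+1]C[k+1] n 1)) ⟩
    (n C 1 ℕ.+ (n C 2)) ℕ.* 2 ℕ.+ suc n
      ≡⟨ cong (λ c → (c ℕ.+ (n C 2)) ℕ.* 2 ℕ.+ suc n) (nC1≡n n) ⟩
    (n ℕ.+ (n C 2)) ℕ.* 2 ℕ.+ suc n
      ≡⟨ regroup n (n C 2) ⟩
    ((n C 2) ℕ.* 2 ℕ.+ n) ℕ.+ (n ℕ.+ suc n)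
      ≡⟨ cong (ℕ._+ (n ℕ.+ suc n)) (choose-2 n) ⟩
    n ℕ.* n ℕ.+ (n ℕ.+ suc n)
      ≡⟨ square n ⟩
    suc n ℕ.* suc n ∎
    where
    regroup : ∀ n c → (n ℕ.+ c) ℕ.* 2 ℕ.+ suc n ≡ (c ℕ.* 2 ℕ.+ n) ℕ.+ (n ℕ.+ suc n)
    regroup = ℕ-Solver.solve-∀
    square : ∀ n → n ℕ.* n ℕ.+ (n ℕ.+ suc n) ≡ suc n ℕ.* suc n
    square = ℕ-Solver.solve-∀

  Q-remaining : ∀ bs (n r δ t : ℕ) → length (+ 2 ∷ + 1 ∷ bs) ≡ r → Σℤ (+ 2 ∷ + 1 ∷ bs) ≡ + n
              → e₂ (+ 2 ∷ + 1 ∷ bs) ≡ + (n C 2) - + t → n ℕ.+ δ ℕ.+ 3 ≡ 3 ℕ.* r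
              → Q bs + + (2 ℕ.* (3 ℕ.* r)) ≡ + (2 ℕ.* (5 ℕ.+ 2 ℕ.* δ ℕ.+ t))
  Q-remaining bs n r δ t length≡r Σ≡n e₂≡ n+δ+3≡3r = begin
    Q bs + + (2 ℕ.* (3 ℕ.* r))
      ≡⟨ cong₂ _+_ (Q-expand bs) (trans (cong +_ (sym (ℕP.*-assoc 2 3 r))) (ℤP.pos-* 6 r)) ⟩
    s * s - + 2 * e₂ bs - + 5 * s + + 6 * + length bs + + 6 * + r
      ≡⟨ quadratic-identity s (e₂ bs) (+ length bs) (+ n) (+ (n C 2)) (+ t) (+ r) (+ δ)
                            Σ≡n e₂≡ C-double N+D+3 (cong +_ length≡r) ⟩
    + 2 * (+ 5 + + 2 * + δ + + t)
      ≡⟨ cong (λ u → + 2 * (+ 5 + u + + t)) (sym (ℤP.pos-* 2 δ)) ⟩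
    + 2 * + (5 ℕ.+ 2 ℕ.* δ ℕ.+ t)
      ≡⟨ sym (ℤP.pos-* 2 (5 ℕ.+ 2 ℕ.* δ ℕ.+ t)) ⟩
    + (2 ℕ.* (5 ℕ.+ 2 ℕ.* δ ℕ.+ t)) ∎
    where
    s = Σℤ bs
    C-double : + (n C 2) * + 2 + + n ≡ + n * + n
    C-double = begin
      + (n C 2) * + 2 + + n     ≡⟨ cong (_+ + n) (sym (ℤP.pos-* (n C 2) 2)) ⟩
      + ((n C 2) ℕ.* 2 ℕ.+ n)   ≡⟨ cong +_ (choose-2 n) ⟩
      + (n ℕ.* n)               ≡⟨ ℤP.pos-* n n ⟩
      + n * + n                 ∎
    N+D+3 : + n + + δ + + 3 ≡ + 3 * + r
    N+D+3 = trans (cong +_ n+δ+3≡3r) (ℤP.pos-* 3 r)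

  nonneg-offset : ∀ x (a b : ℕ) → 0ℤ ≤ x → x + + a ≡ + b → a ℕ.≤ b × (x ≡ 0ℤ ⇔ a ≡ b)
  nonneg-offset (+ k) a b _ h = subst (a ℕ.≤_) k+a≡b (ℕP.m≤n+m a k)
                              , mk⇔ (λ { refl → k+a≡b })
                                    (λ a≡b → cong +_ (ℕP.+-cancelʳ-≡ a k 0 (trans k+a≡b (sym a≡b))))
    where
    k+a≡b : k ℕ.+ a ≡ b
    k+a≡b = ℤP.+-injective h

  two-three-product : ∀ bs → All TwoOrThree bs → Σ ℕ λ c₂ → Σ ℕ λ c₃ →
    (length bs ≡ c₂ ℕ.+ c₃) × (Σℤ bs ≡ + (2 ℕ.* c₂ ℕ.+ 3 ℕ.* c₃))
    × (∀ x → prodLin bs x ≡ (x - + 2) ^ c₂ * (x - + 3) ^ c₃)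
  two-three-product []       []                = 0 , 0 , refl , refl , λ x → refl
  two-three-product (b ∷ bs) (inj₁ refl ∷ all) with two-three-product bs all
  ... | c₂ , c₃ , count , sum , product =
        suc c₂ , c₃ , cong suc count , trans (cong (_+_ (+ 2)) sum) (cong +_ (add-two c₂ c₃))
      , λ x → trans (cong ((x - + 2) *_) (product x)) (sym (ℤP.*-assoc (x - + 2) _ _))
    where
    add-two : ∀ c₂ c₃ → 2 ℕ.+ (2 ℕ.* c₂ ℕ.+ 3 ℕ.* c₃) ≡ 2 ℕ.* suc c₂ ℕ.+ 3 ℕ.* c₃
    add-two = ℕ-Solver.solve-∀
  two-three-product (b ∷ bs) (inj₂ refl ∷ all) with two-three-product bs all
  ... | c₂ , c₃ , count , sum , product =
        c₂ , suc c₃ , trans (cong suc count) (sym (ℕP.+-suc c₂ c₃))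
      , trans (cong (_+_ (+ 3)) sum) (cong +_ (add-three c₂ c₃))
      , λ x → trans (cong ((x - + 3) *_) (product x)) (swap (x - + 3) ((x - + 2) ^ c₂) ((x - + 3) ^ c₃))
    where
    add-three : ∀ c₂ c₃ → 3 ℕ.+ (2 ℕ.* c₂ ℕ.+ 3 ℕ.* c₃) ≡ 2 ℕ.* c₂ ℕ.+ 3 ℕ.* suc c₃
    add-three = ℕ-Solver.solve-∀
    swap : ∀ (u A B : ℤ) → u * (A * B) ≡ A * (u * B)
    swap = solve-∀

  target : ℕ → ℕ → ℤ → ℤ
  target r δ x = (x - + 1) * ((x - + 2) ^ (δ ℕ.+ 1)) * ((x - + 3) ^ (r ∸ 2 ∸ δ))

  target-shape : ∀ r δ c₂ c₃ x → c₂ ≡ δ → r ∸ 2 ∸ δ ≡ c₃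
               → (x - + 2) * ((x - + 1) * ((x - + 2) ^ c₂ * (x - + 3) ^ c₃)) ≡ target r δ x
  target-shape r δ _ _ x refl refl = begin
    (x - + 2) * ((x - + 1) * ((x - + 2) ^ δ * (x - + 3) ^ (r ∸ 2 ∸ δ)))
      ≡⟨ regroup (x - + 2) (x - + 1) ((x - + 2) ^ δ) ((x - + 3) ^ (r ∸ 2 ∸ δ)) ⟩
    (x - + 1) * ((x - + 2) * (x - + 2) ^ δ) * (x - + 3) ^ (r ∸ 2 ∸ δ)
      ≡⟨ cong (λ k → (x - + 1) * ((x - + 2) ^ k) * (x - + 3) ^ (r ∸ 2 ∸ δ)) (ℕP.+-comm 1 δ) ⟩
    target r δ x ∎
    where
    regroup : ∀ (u v A B : ℤ) → u * (v * (A * B)) ≡ v * (u * A) * B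
    regroup = solve-∀

  -- If the remaining roots are all 2 or 3, their multiplicities are forced
  -- by the length r and the sum n, and the product is the target.
  two-three⇒target : ∀ bs (n r δ : ℕ) → All TwoOrThree bs
    → length (+ 2 ∷ + 1 ∷ bs) ≡ r → Σℤ (+ 2 ∷ + 1 ∷ bs) ≡ + n → n ℕ.+ δ ℕ.+ 3 ≡ 3 ℕ.* r
    → ∀ x → prodLin (+ 2 ∷ + 1 ∷ bs) x ≡ target r δ x
  two-three⇒target bs n r δ all length≡r Σ≡n n+δ+3≡3r x with two-three-product bs all
  ... | c₂ , c₃ , count , sum , product =
    trans (cong (λ u → (x - + 2) * ((x - + 1) * u)) (product x)) (target-shape r δ c₂ c₃ x c₂≡δ c₃≡)
    where
    r≡ : 2 ℕ.+ (c₂ ℕ.+ c₃) ≡ r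
    r≡ = trans (cong (λ m → suc (suc m)) (sym count)) length≡r
    n≡ : 3 ℕ.+ (2 ℕ.* c₂ ℕ.+ 3 ℕ.* c₃) ≡ n
    n≡ = ℤP.+-injective (trans (cong (λ u → + 2 + (+ 1 + u)) (sym sum)) Σ≡n)
    -- n + δ + 3 = 3r becomes (2c₂ + 3c₃ + 6) + δ = (2c₂ + 3c₃ + 6) + c₂.
    c₂≡δ : c₂ ≡ δ
    c₂≡δ = sym (ℕP.+-cancelʳ-≡ (2 ℕ.* c₂ ℕ.+ 3 ℕ.* c₃ ℕ.+ 6) δ c₂ (begin
      δ ℕ.+ (2 ℕ.* c₂ ℕ.+ 3 ℕ.* c₃ ℕ.+ 6)   ≡⟨ sym (left c₂ c₃ δ) ⟩
      3 ℕ.+ (2 ℕ.* c₂ ℕ.+ 3 ℕ.* c₃) ℕ.+ δ ℕ.+ 3  ≡⟨ cong (λ m → m ℕ.+ δ ℕ.+ 3) n≡ ⟩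
      n ℕ.+ δ ℕ.+ 3                          ≡⟨ n+δ+3≡3r ⟩
      3 ℕ.* r                                ≡⟨ cong (3 ℕ.*_) (sym r≡) ⟩
      3 ℕ.* (2 ℕ.+ (c₂ ℕ.+ c₃))              ≡⟨ right c₂ c₃ ⟩
      c₂ ℕ.+ (2 ℕ.* c₂ ℕ.+ 3 ℕ.* c₃ ℕ.+ 6)   ∎))
      where
      left : ∀ c₂ c₃ δ → 3 ℕ.+ (2 ℕ.* c₂ ℕ.+ 3 ℕ.* c₃) ℕ.+ δ ℕ.+ 3 ≡ δ ℕ.+ (2 ℕ.* c₂ ℕ.+ 3 ℕ.* c₃ ℕ.+ 6)
      left = ℕ-Solver.solve-∀
      right : ∀ c₂ c₃ → 3 ℕ.* (2 ℕ.+ (c₂ ℕ.+ c₃)) ≡ c₂ ℕ.+ (2 ℕ.* c₂ ℕ.+ 3 ℕ.* c₃ ℕ.+ 6)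
      right = ℕ-Solver.solve-∀
    c₃≡ : r ∸ 2 ∸ δ ≡ c₃
    c₃≡ = begin
      r ∸ 2 ∸ δ                  ≡⟨ cong (λ k → k ∸ 2 ∸ δ) (sym r≡) ⟩
      2 ℕ.+ (c₂ ℕ.+ c₃) ∸ 2 ∸ δ  ≡⟨ cong (_∸ δ) (ℕP.m+n∸m≡n 2 (c₂ ℕ.+ c₃)) ⟩
      c₂ ℕ.+ c₃ ∸ δ              ≡⟨ cong (λ d → c₂ ℕ.+ c₃ ∸ d) (sym c₂≡δ) ⟩
      c₂ ℕ.+ c₃ ∸ c₂             ≡⟨ ℕP.m+n∸m≡n c₂ c₃ ⟩
      c₃                         ∎

  extremal-roots : ℕ → ℕ → List ℤ
  extremal-roots r δ = replicate δ (+ 2) ++ replicate (r ∸ 2 ∸ δ) (+ 3)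

  extremal-roots-are-two-three : ∀ r δ → All TwoOrThree (extremal-roots r δ)
  extremal-roots-are-two-three r δ =
    AllP.++⁺ (AllP.replicate⁺ δ (inj₁ refl)) (AllP.replicate⁺ (r ∸ 2 ∸ δ) (inj₂ refl))

  prodLin-++ : ∀ xs ys x → prodLin (xs ++ ys) x ≡ prodLin xs x * prodLin ys x
  prodLin-++ []       ys x = sym (ℤP.*-identityˡ _)
  prodLin-++ (a ∷ xs) ys x = trans (cong ((x - a) *_) (prodLin-++ xs ys x)) (sym (ℤP.*-assoc (x - a) _ _))

  prodLin-replicate : ∀ k a x → prodLin (replicate k a) x ≡ (x - a) ^ k
  prodLin-replicate zero    a x = refl
  prodLin-replicate (suc k) a x = cong ((x - a) *_) (prodLin-replicate k a x)

  target-factors : ∀ r δ x → target r δ x ≡ prodLin (+ 2 ∷ + 1 ∷ extremal-roots r δ) x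
  target-factors r δ x = sym (begin
    (x - + 2) * ((x - + 1) * prodLin (extremal-roots r δ) x)
      ≡⟨ cong (λ u → (x - + 2) * ((x - + 1) * u)) (begin
           prodLin (extremal-roots r δ) x
             ≡⟨ prodLin-++ (replicate δ (+ 2)) _ x ⟩
           prodLin (replicate δ (+ 2)) x * prodLin (replicate (r ∸ 2 ∸ δ) (+ 3)) x
             ≡⟨ cong₂ _*_ (prodLin-replicate δ (+ 2) x) (prodLin-replicate (r ∸ 2 ∸ δ) (+ 3) x) ⟩
           (x - + 2) ^ δ * (x - + 3) ^ (r ∸ 2 ∸ δ) ∎) ⟩
    (x - + 2) * ((x - + 1) * ((x - + 2) ^ δ * (x - + 3) ^ (r ∸ 2 ∸ δ)))
      ≡⟨ target-shape r δ δ (r ∸ 2 ∸ δ) x refl refl ⟩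
    target r δ x ∎)

  halve-bound : ∀ r δ t → 2 ℕ.* (3 ℕ.* r) ℕ.≤ 2 ℕ.* (5 ℕ.+ 2 ℕ.* δ ℕ.+ t) → 3 ℕ.* r ∸ (5 ℕ.+ 2 ℕ.* δ) ℕ.≤ t
  halve-bound r δ t h = ℕP.m≤n+o⇒m∸n≤o (3 ℕ.* r) (5 ℕ.+ 2 ℕ.* δ) (ℕP.*-cancelˡ-≤ 2 h)

  halve-tight : ∀ r δ t → δ ℕ.+ 2 ℕ.≤ r
    → (2 ℕ.* (3 ℕ.* r) ≡ 2 ℕ.* (5 ℕ.+ 2 ℕ.* δ ℕ.+ t) ⇔ t ≡ 3 ℕ.* r ∸ (5 ℕ.+ 2 ℕ.* δ))
  halve-tight r δ t δ+2≤r = mk⇔ to from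
    where
    d = 5 ℕ.+ 2 ℕ.* δ
    d≤3r : d ℕ.≤ 3 ℕ.* r
    d≤3r = ℕP.≤-trans (ℕP.≤-trans (ℕP.m≤m+n d (suc δ)) (ℕP.≤-reflexive (expand δ))) (ℕP.*-monoʳ-≤ 3 δ+2≤r)
      where
      expand : ∀ δ → 5 ℕ.+ 2 ℕ.* δ ℕ.+ suc δ ≡ 3 ℕ.* (δ ℕ.+ 2)
      expand = ℕ-Solver.solve-∀
    to : 2 ℕ.* (3 ℕ.* r) ≡ 2 ℕ.* (d ℕ.+ t) → t ≡ 3 ℕ.* r ∸ d
    to h = begin
      t                ≡⟨ sym (ℕP.m+n∸m≡n d t) ⟩
      d ℕ.+ t ∸ d      ≡⟨ cong (_∸ d) (sym (ℕP.*-cancelˡ-≡ (3 ℕ.* r) (d ℕ.+ t) 2 h)) ⟩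
      3 ℕ.* r ∸ d      ∎
    from : t ≡ 3 ℕ.* r ∸ d → 2 ℕ.* (3 ℕ.* r) ≡ 2 ℕ.* (d ℕ.+ t)
    from t≡ = cong (2 ℕ.*_) (sym (trans (cong (d ℕ.+_) t≡) (ℕP.m+[n∸m]≡n d≤3r)))

  -- The hypotheses force a nonempty ground set: n = 0 would give δ + 3 = 3r ≥ 3δ + 6.
  ground-nonempty : ∀ n r δ → n ℕ.+ δ ℕ.+ 3 ≡ 3 ℕ.* r → δ ℕ.+ 2 ℕ.≤ r → 1 ℕ.≤ n
  ground-nonempty (suc n) r δ _       _     = ℕ.s≤s ℕ.z≤n
  ground-nonempty zero    r δ δ+3≡3r δ+2≤r = ⊥-elim (ℕP.m+1+n≰m (δ ℕ.+ 3)
    (ℕP.≤-trans (ℕP.≤-reflexive (expand δ)) (ℕP.≤-trans (ℕP.*-monoʳ-≤ 3 δ+2≤r) (ℕP.≤-reflexive (sym δ+3≡3r)))))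
    where
    expand : ∀ δ → δ ℕ.+ 3 ℕ.+ suc (2 ℕ.* δ ℕ.+ 2) ≡ 3 ℕ.* (δ ℕ.+ 2)
    expand = ℕ-Solver.solve-∀

  -- Splitting off the roots
  -- 2 and 1 leaves roots bs with Q(bs) + 2·3r = 2(5 + 2δ + t); since Q(bs) ≥ 0
  -- this bounds t, and equality means every remaining root is 2 or 3.
  root-count : (n r δ t : ℕ) (χf : ℤ → ℤ) → n ℕ.+ δ ℕ.+ 3 ≡ 3 ℕ.* r → δ ℕ.+ 2 ℕ.≤ r
    → (∀ as → (∀ x → χf x ≡ prodLin as x) → length as ≡ r × Σℤ as ≡ + n × e₂ as ≡ + (n C 2) - + t)
    → χf (+ 1) ≡ 0ℤ → ∃ (λ as → ∀ x → χf x ≡ prodLin as x) → χf (+ 2) ≡ 0ℤ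
    → (3 ℕ.* r ∸ (5 ℕ.+ 2 ℕ.* δ) ℕ.≤ t)
      × (t ≡ 3 ℕ.* r ∸ (5 ℕ.+ 2 ℕ.* δ) ⇔ (∀ x → χf x ≡ target r δ x))
  root-count n r δ t χf n+δ+3≡3r δ+2≤r coefficients χf[1]≡0 (as , χf≡) χf[2]≡0 =
    halve-bound r δ t (proj₁ (offset bs χf≡bs)) , mk⇔ tight⇒target target⇒tight
    where
    offset : ∀ bs → (∀ x → χf x ≡ prodLin (+ 2 ∷ + 1 ∷ bs) x)
           → 2 ℕ.* (3 ℕ.* r) ℕ.≤ 2 ℕ.* (5 ℕ.+ 2 ℕ.* δ ℕ.+ t)
             × (Q bs ≡ 0ℤ ⇔ 2 ℕ.* (3 ℕ.* r) ≡ 2 ℕ.* (5 ℕ.+ 2 ℕ.* δ ℕ.+ t))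
    offset bs χf≡bs with coefficients (+ 2 ∷ + 1 ∷ bs) χf≡bs
    ... | length≡r , Σ≡n , e₂≡ =
      nonneg-offset (Q bs) _ _ (Q-nonneg bs) (Q-remaining bs n r δ t length≡r Σ≡n e₂≡ n+δ+3≡3r)

    split = split-1-2 as (trans (sym (χf≡ (+ 1))) χf[1]≡0) (trans (sym (χf≡ (+ 2))) χf[2]≡0)
    bs = proj₁ split
    χf≡bs : ∀ x → χf x ≡ prodLin (+ 2 ∷ + 1 ∷ bs) x
    χf≡bs x = trans (χf≡ x) (proj₂ split x)

    tight⇒target : t ≡ 3 ℕ.* r ∸ (5 ℕ.+ 2 ℕ.* δ) → ∀ x → χf x ≡ target r δ x
    tight⇒target t≡ x with coefficients (+ 2 ∷ + 1 ∷ bs) χf≡bs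
    ... | length≡r , Σ≡n , _ = trans (χf≡bs x)
          (two-three⇒target bs n r δ (Q≡0⇒two-three bs Q≡0) length≡r Σ≡n n+δ+3≡3r x)
      where
      Q≡0 : Q bs ≡ 0ℤ
      Q≡0 = Equivalence.from (proj₂ (offset bs χf≡bs)) (Equivalence.from (halve-tight r δ t δ+2≤r) t≡)

    target⇒tight : (∀ x → χf x ≡ target r δ x) → t ≡ 3 ℕ.* r ∸ (5 ℕ.+ 2 ℕ.* δ)
    target⇒tight χf≡target = Equivalence.to (halve-tight r δ t δ+2≤r)
      (Equivalence.to (proj₂ (offset extremal χf≡extremal))
        (two-three⇒Q≡0 extremal (extremal-roots-are-two-three r δ)))
      where
      extremal = extremal-roots r δ
      χf≡extremal : ∀ x → χf x ≡ prodLin (+ 2 ∷ + 1 ∷ extremal) x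
      χf≡extremal x = trans (χf≡target x) (target-factors r δ x)

module Booleans where

  open import Data.Bool using (Bool; true; false; _∧_; not; T)
  open import Data.List using ([]; _∷_)
  open import Data.List.Membership.Propositional using (_∈_)
  open import Data.List.Relation.Unary.Any using (here; there)
  open import Data.Product using (Σ; _,_)
  open import Data.Empty using (⊥-elim)
  open import Data.Unit using (tt)
  open import Relation.Nullary using (¬_)
  open import Relation.Binary.PropositionalEquality

  ∧-intro : ∀ {a b} → T a → T b → T (a ∧ b)
  ∧-intro {true} {true} _ _ = tt

  ∧-fst : ∀ {a b} → T (a ∧ b) → T a
  ∧-fst {true} _ = tt

  ∧-snd : ∀ {a b} → T (a ∧ b) → T b
  ∧-snd {true} t = t

  T-ext : ∀ {a b} → (T a → T b) → (T b → T a) → a ≡ b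
  T-ext {true}  {true}  _ _ = refl
  T-ext {true}  {false} f _ = ⊥-elim (f tt)
  T-ext {false} {true}  _ g = ⊥-elim (g tt)
  T-ext {false} {false} _ _ = refl

  allᵇ-elim : ∀ {A : Set} (p : A → Bool) xs → T (allᵇ p xs) → ∀ x → x ∈ xs → T (p x)
  allᵇ-elim p (y ∷ ys) t x (here refl) = ∧-fst t
  allᵇ-elim p (y ∷ ys) t x (there x∈) = allᵇ-elim p ys (∧-snd {p y} t) x x∈

  allᵇ-intro : ∀ {A : Set} (p : A → Bool) xs → (∀ x → T (p x)) → T (allᵇ p xs)
  allᵇ-intro p []       h = tt
  allᵇ-intro p (y ∷ ys) h = ∧-intro (h y) (allᵇ-intro p ys h)

  allᵇ-counterexample : ∀ {A : Set} (p : A → Bool) xs → ¬ T (allᵇ p xs) → Σ A λ x → ¬ T (p x)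
  allᵇ-counterexample p []       h = ⊥-elim (h tt)
  allᵇ-counterexample p (y ∷ ys) h with p y in eq
  ... | true  = allᵇ-counterexample p ys h
  ... | false = y , λ t → subst T eq t

  not-T : ∀ b → T (not b) → ¬ T b
  not-T true  () _
  not-T false _  ()

module Subsets where

  open import Data.Nat using (suc; _≤_; _<_; s≤s)
  import Data.Nat.Properties as ℕP
  open import Data.Bool using (Bool; true; false; _∧_; _∨_; not; T)
  open import Data.Fin using (Fin; zero; suc)
  import Data.Fin.Properties as FinP
  open import Data.Fin.Subset
  open import Data.Fin.Subset.Properties
  open import Data.Vec using ([]; _∷_; here; there)
  open import Data.Product using (Σ; _×_; _,_)
  open import Data.Sum using (inj₁; inj₂)
  open import Data.Empty using (⊥-elim)
  open import Data.Unit using (tt)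
  open import Relation.Nullary using (¬_)
  open import Relation.Binary.PropositionalEquality
  open Booleans

  size-0 : ∀ {n} (X : Subset n) → ∣ X ∣ ≡ 0 → X ≡ ⊥
  size-0 []          _  = refl
  size-0 (false ∷ X) h  = cong (false ∷_) (size-0 X h)
  size-0 (true ∷ X)  ()

  size-1 : ∀ {n} (X : Subset n) → ∣ X ∣ ≡ 1 → Σ (Fin n) λ e → X ≡ ⁅ e ⁆
  size-1 (false ∷ X) h with size-1 X h
  ... | e , X≡e = suc e , cong (false ∷_) X≡e
  size-1 (true ∷ X)  h = zero , cong (true ∷_) (size-0 X (ℕP.suc-injective h))

  element : ∀ {n} (X : Subset n) → 1 ≤ ∣ X ∣ → Σ (Fin n) (_∈ X)
  element (false ∷ X) h with element X h
  ... | e , e∈X = suc e , there e∈X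
  element (true ∷ X)  h = zero , here

  two-elements : ∀ {n} (X : Subset n) → 2 ≤ ∣ X ∣
               → Σ (Fin n) λ e → Σ (Fin n) λ f → e ∈ X × f ∈ X × ¬ e ≡ f
  two-elements (false ∷ X) h with two-elements X h
  ... | e , f , e∈X , f∈X , e≢f = suc e , suc f , there e∈X , there f∈X , (λ eq → e≢f (FinP.suc-injective eq))
  two-elements (true ∷ X) (s≤s h) with element X h
  ... | f , f∈X = zero , suc f , here , there f∈X , (λ ())

  ⊆-size-eq : ∀ {n} (Y X : Subset n) → Y ⊆ X → ∣ X ∣ ≤ ∣ Y ∣ → Y ≡ X
  ⊆-size-eq []          []          _   _       = refl
  ⊆-size-eq (true ∷ Y)  (true ∷ X)  Y⊆X (s≤s h) = cong (true ∷_) (⊆-size-eq Y X (drop-∷-⊆ Y⊆X) h)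
  ⊆-size-eq (false ∷ Y) (false ∷ X) Y⊆X h       = cong (false ∷_) (⊆-size-eq Y X (drop-∷-⊆ Y⊆X) h)
  ⊆-size-eq (true ∷ Y)  (false ∷ X) Y⊆X _ with Y⊆X here
  ... | ()
  ⊆-size-eq (false ∷ Y) (true ∷ X)  Y⊆X h =
    ⊥-elim (ℕP.<-irrefl refl (ℕP.≤-trans (s≤s (p⊆q⇒∣p∣≤∣q∣ (drop-∷-⊆ Y⊆X))) h))

  proper-size : ∀ {n} (Y X : Subset n) → Y ⊆ X → ¬ Y ≡ X → ∣ Y ∣ < ∣ X ∣
  proper-size Y X Y⊆X Y≢X with ℕP.<-≤-connex ∣ Y ∣ ∣ X ∣
  ... | inj₁ lt = lt
  ... | inj₂ ge = ⊥-elim (Y≢X (⊆-size-eq Y X Y⊆X ge))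

  size-∪-new : ∀ {n} (Z : Subset n) e → e ∉ Z → ∣ Z ∪ ⁅ e ⁆ ∣ ≡ suc ∣ Z ∣
  size-∪-new (true ∷ Z)  zero    e∉Z = ⊥-elim (e∉Z here)
  size-∪-new (false ∷ Z) zero    _   = cong (λ W → suc ∣ W ∣) (∪-identityʳ Z)
  size-∪-new (true ∷ Z)  (suc e) e∉Z = cong suc (size-∪-new Z e (λ p → e∉Z (there p)))
  size-∪-new (false ∷ Z) (suc e) e∉Z = size-∪-new Z e (λ p → e∉Z (there p))

  ∪-⊆ : ∀ {n} {X Y Z : Subset n} → X ⊆ Z → Y ⊆ Z → X ∪ Y ⊆ Z
  ∪-⊆ {X = X} {Y} X⊆Z Y⊆Z p with x∈p∪q⁻ X Y p
  ... | inj₁ q = X⊆Z q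
  ... | inj₂ q = Y⊆Z q

  ⁅⁆-⊆ : ∀ {n} {X : Subset n} {e} → e ∈ X → ⁅ e ⁆ ⊆ X
  ⁅⁆-⊆ {X = X} {e} e∈X p = subst (_∈ X) (sym (x∈⁅y⁆⇒x≡y e p)) e∈X

  infix 4 _⊆ᵇ_
  _⊆ᵇ_ : ∀ {n} → Subset n → Subset n → Bool
  []      ⊆ᵇ []      = true
  (y ∷ Y) ⊆ᵇ (x ∷ X) = (not y ∨ x) ∧ (Y ⊆ᵇ X)

  ⊆ᵇ-sound : ∀ {n} (Y X : Subset n) → T (Y ⊆ᵇ X) → Y ⊆ X
  ⊆ᵇ-sound (true ∷ Y)  (true ∷ X) t here      = here
  ⊆ᵇ-sound (true ∷ Y)  (true ∷ X) t (there p) = there (⊆ᵇ-sound Y X t p)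
  ⊆ᵇ-sound (false ∷ Y) (x ∷ X)    t (there p) = there (⊆ᵇ-sound Y X t p)

  ⊆ᵇ-complete : ∀ {n} (Y X : Subset n) → Y ⊆ X → T (Y ⊆ᵇ X)
  ⊆ᵇ-complete []          []         _   = tt
  ⊆ᵇ-complete (true ∷ Y)  (true ∷ X) Y⊆X = ⊆ᵇ-complete Y X (drop-∷-⊆ Y⊆X)
  ⊆ᵇ-complete (false ∷ Y) (x ∷ X)    Y⊆X = ⊆ᵇ-complete Y X (drop-∷-⊆ Y⊆X)
  ⊆ᵇ-complete (true ∷ Y)  (false ∷ X) Y⊆X with Y⊆X here
  ... | ()

module FiniteSums where

  open import Data.Nat as ℕ using (ℕ; zero; suc)
  open import Data.Nat.Combinatorics using (_C_; nCk+nC[k+1]≡[n+1]C[k+1])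
  open import Data.Integer using (ℤ; +_; _+_; _*_; 0ℤ; 1ℤ)
  import Data.Integer.Properties as ℤP
  open import Data.Bool using (Bool; true; false; _∧_; T)
  open import Data.Bool.Properties using (T?)
  open import Data.List using ([]; _∷_; map; filter; _++_; length)
  open import Data.List.Properties using (map-++)
  open import Data.List.Membership.Propositional using (_∈_)
  open import Data.List.Relation.Unary.Any using (here; there)
  open import Data.Vec using ([]; _∷_; head; tail)
  open import Data.Fin.Subset using (Subset; inside; outside; ∣_∣)
  open import Data.Unit using (tt)
  open import Data.Empty using (⊥-elim)
  open import Relation.Nullary using (¬_)
  open import Relation.Binary.PropositionalEquality
  open import Data.Integer.Tactic.RingSolver using (solve-∀)
  open ≡-Reasoning
  open Polynomial using (Σℤ)
  open Subsets using (_⊆ᵇ_)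

  𝟙 : Bool → ℤ
  𝟙 true  = 1ℤ
  𝟙 false = 0ℤ

  𝟙-∧ : ∀ a b → 𝟙 (a ∧ b) ≡ 𝟙 a * 𝟙 b
  𝟙-∧ true  b = sym (ℤP.*-identityˡ (𝟙 b))
  𝟙-∧ false b = refl

  𝟙-∧-false : ∀ a → 𝟙 (a ∧ false) ≡ 0ℤ
  𝟙-∧-false true  = refl
  𝟙-∧-false false = refl

  Σ-cong : ∀ {A : Set} {g h : A → ℤ} xs → (∀ x → x ∈ xs → g x ≡ h x)
         → Σℤ (map g xs) ≡ Σℤ (map h xs)
  Σ-cong []       e = refl
  Σ-cong (x ∷ xs) e = cong₂ _+_ (e x (here refl)) (Σ-cong xs (λ y m → e y (there m)))

  Σ-zero : ∀ {A : Set} (g : A → ℤ) xs → (∀ x → g x ≡ 0ℤ) → Σℤ (map g xs) ≡ 0ℤ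
  Σ-zero g []       e = refl
  Σ-zero g (x ∷ xs) e = cong₂ _+_ (e x) (Σ-zero g xs e)

  Σ-++ : ∀ xs ys → Σℤ (xs ++ ys) ≡ Σℤ xs + Σℤ ys
  Σ-++ []       ys = sym (ℤP.+-identityˡ _)
  Σ-++ (x ∷ xs) ys = trans (cong (_+_ x) (Σ-++ xs ys)) (sym (ℤP.+-assoc x _ _))

  Σ-map-map : ∀ {A B : Set} (g : B → ℤ) (f : A → B) xs
            → Σℤ (map g (map f xs)) ≡ Σℤ (map (λ a → g (f a)) xs)
  Σ-map-map g f []       = refl
  Σ-map-map g f (x ∷ xs) = cong (_+_ (g (f x))) (Σ-map-map g f xs)

  Σ-+ : ∀ {A : Set} (g h : A → ℤ) xs
      → Σℤ (map (λ x → g x + h x) xs) ≡ Σℤ (map g xs) + Σℤ (map h xs)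
  Σ-+ g h []       = refl
  Σ-+ g h (x ∷ xs) = trans (cong (_+_ (g x + h x)) (Σ-+ g h xs)) (swap-middle (g x) (h x) _ _)
    where
    swap-middle : ∀ (a b c d : ℤ) → a + b + (c + d) ≡ a + c + (b + d)
    swap-middle = solve-∀

  Σ-scale : ∀ {A : Set} (c : ℤ) (g : A → ℤ) xs → Σℤ (map (λ x → c * g x) xs) ≡ c * Σℤ (map g xs)
  Σ-scale c g []       = sym (ℤP.*-zeroʳ c)
  Σ-scale c g (x ∷ xs) = trans (cong (_+_ (c * g x)) (Σ-scale c g xs)) (sym (ℤP.*-distribˡ-+ c (g x) _))

  Σ-swap : ∀ {A B : Set} (f : A → B → ℤ) xs ys
         → Σℤ (map (λ x → Σℤ (map (f x) ys)) xs) ≡ Σℤ (map (λ y → Σℤ (map (λ x → f x y) xs)) ys)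
  Σ-swap f []       ys = sym (Σ-zero (λ _ → 0ℤ) ys (λ _ → refl))
  Σ-swap f (x ∷ xs) ys = trans (cong (_+_ (Σℤ (map (f x) ys))) (Σ-swap f xs ys))
                               (sym (Σ-+ (f x) (λ y → Σℤ (map (λ x′ → f x′ y) xs)) ys))

  Σ-filter : ∀ {A : Set} (b : A → Bool) (g : A → ℤ) xs
           → Σℤ (map g (filter (λ x → T? (b x)) xs)) ≡ Σℤ (map (λ x → 𝟙 (b x) * g x) xs)
  Σ-filter b g []       = refl
  Σ-filter b g (x ∷ xs) with b x
  ... | true  = cong₂ _+_ (sym (ℤP.*-identityˡ (g x))) (Σ-filter b g xs)
  ... | false = trans (Σ-filter b g xs) (sym (ℤP.+-identityˡ _))

  length-filter : ∀ {A : Set} (b : A → Bool) xs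
                → + length (filter (λ x → T? (b x)) xs) ≡ Σℤ (map (λ x → 𝟙 (b x)) xs)
  length-filter b []       = refl
  length-filter b (x ∷ xs) with b x
  ... | true  = cong (_+_ 1ℤ) (length-filter b xs)
  ... | false = trans (length-filter b xs) (sym (ℤP.+-identityˡ _))

  ΣS : ∀ {n} → (Subset n → ℤ) → ℤ
  ΣS {n} g = Σℤ (map g (allSubsets n))

  ΣS-suc : ∀ {n} (g : Subset (suc n) → ℤ)
         → ΣS g ≡ ΣS (λ Y → g (inside ∷ Y)) + ΣS (λ Y → g (outside ∷ Y))
  ΣS-suc {n} g = begin
    Σℤ (map g (map (inside ∷_) S ++ map (outside ∷_) S))
      ≡⟨ cong Σℤ (map-++ g (map (inside ∷_) S) (map (outside ∷_) S)) ⟩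
    Σℤ (map g (map (inside ∷_) S) ++ map g (map (outside ∷_) S))
      ≡⟨ Σ-++ (map g (map (inside ∷_) S)) _ ⟩
    Σℤ (map g (map (inside ∷_) S)) + Σℤ (map g (map (outside ∷_) S))
      ≡⟨ cong₂ _+_ (Σ-map-map g _ S) (Σ-map-map g _ S) ⟩
    ΣS (λ Y → g (inside ∷ Y)) + ΣS (λ Y → g (outside ∷ Y)) ∎
    where
    S = allSubsets n

  ΣS-none : ∀ {n} (b : Subset n → Bool) (g : Subset n → ℤ)
          → (∀ X → ¬ T (b X)) → ΣS (λ X → 𝟙 (b X) * g X) ≡ 0ℤ
  ΣS-none {n} b g never = Σ-zero _ (allSubsets n) vanish
    where
    vanish : ∀ X → 𝟙 (b X) * g X ≡ 0ℤ
    vanish X with b X | never X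
    ... | true  | ¬t = ⊥-elim (¬t tt)
    ... | false | _  = refl

  -- A sum whose indicator selects exactly one subset X₀ picks out the value at X₀
  -- (induction on n: only the half of the subsets agreeing with X₀ in the
  -- first coordinate can contribute).
  ΣS-unique : ∀ {n} (b : Subset n → Bool) (g : Subset n → ℤ) X₀
            → (∀ X → T (b X) → X ≡ X₀) → T (b X₀) → ΣS (λ X → 𝟙 (b X) * g X) ≡ g X₀
  ΣS-unique {zero} b g [] unique bX₀ with b []
  ... | true = trans (ℤP.+-identityʳ _) (ℤP.*-identityˡ (g []))
  ΣS-unique {suc n} b g (true ∷ X₀) unique bX₀ = begin
    ΣS (λ X → 𝟙 (b X) * g X)            ≡⟨ ΣS-suc (λ X → 𝟙 (b X) * g X) ⟩
    ΣS (λ Y → 𝟙 (b (true ∷ Y)) * g (true ∷ Y)) + ΣS (λ Y → 𝟙 (b (false ∷ Y)) * g (false ∷ Y))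
      ≡⟨ cong₂ _+_ (ΣS-unique (λ Y → b (true ∷ Y)) (λ Y → g (true ∷ Y)) X₀
                              (λ Y t → cong tail (unique _ t)) bX₀)
                   (ΣS-none (λ Y → b (false ∷ Y)) (λ Y → g (false ∷ Y))
                            (λ Y t → false≢true (cong head (unique _ t)))) ⟩
    g (true ∷ X₀) + 0ℤ                  ≡⟨ ℤP.+-identityʳ _ ⟩
    g (true ∷ X₀)                       ∎
    where
    false≢true : ¬ false ≡ true
    false≢true ()
  ΣS-unique {suc n} b g (false ∷ X₀) unique bX₀ = begin
    ΣS (λ X → 𝟙 (b X) * g X)            ≡⟨ ΣS-suc (λ X → 𝟙 (b X) * g X) ⟩
    ΣS (λ Y → 𝟙 (b (true ∷ Y)) * g (true ∷ Y)) + ΣS (λ Y → 𝟙 (b (false ∷ Y)) * g (false ∷ Y))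
      ≡⟨ cong₂ _+_ (ΣS-none (λ Y → b (true ∷ Y)) (λ Y → g (true ∷ Y))
                            (λ Y t → true≢false (cong head (unique _ t))))
                   (ΣS-unique (λ Y → b (false ∷ Y)) (λ Y → g (false ∷ Y)) X₀
                              (λ Y t → cong tail (unique _ t)) bX₀) ⟩
    0ℤ + g (false ∷ X₀)                 ≡⟨ ℤP.+-identityˡ _ ⟩
    g (false ∷ X₀)                      ∎
    where
    true≢false : ¬ true ≡ false
    true≢false ()

  ΣS-size : ∀ n k → ΣS {n} (λ X → 𝟙 (∣ X ∣ ℕ.≡ᵇ k)) ≡ + (n C k)
  ΣS-size zero    zero    = refl
  ΣS-size zero    (suc k) = refl
  ΣS-size (suc n) zero    = begin
    ΣS {suc n} (λ X → 𝟙 (∣ X ∣ ℕ.≡ᵇ 0))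
      ≡⟨ ΣS-suc {n} (λ X → 𝟙 (∣ X ∣ ℕ.≡ᵇ 0)) ⟩
    ΣS {n} (λ _ → 0ℤ) + ΣS {n} (λ Y → 𝟙 (∣ Y ∣ ℕ.≡ᵇ 0))
      ≡⟨ cong₂ _+_ (Σ-zero _ (allSubsets n) (λ _ → refl)) (ΣS-size n 0) ⟩
    0ℤ + + (n C 0) ∎
  ΣS-size (suc n) (suc k) = begin
    ΣS {suc n} (λ X → 𝟙 (∣ X ∣ ℕ.≡ᵇ suc k))
      ≡⟨ ΣS-suc {n} (λ X → 𝟙 (∣ X ∣ ℕ.≡ᵇ suc k)) ⟩
    ΣS {n} (λ Y → 𝟙 (∣ Y ∣ ℕ.≡ᵇ k)) + ΣS {n} (λ Y → 𝟙 (∣ Y ∣ ℕ.≡ᵇ suc k))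
      ≡⟨ cong₂ _+_ (ΣS-size n k) (ΣS-size n (suc k)) ⟩
    + (n C k) + + (n C suc k)     ≡⟨ sym (ℤP.pos-+ (n C k) (n C suc k)) ⟩
    + (n C k ℕ.+ n C suc k)       ≡⟨ cong +_ (nCk+nC[k+1]≡[n+1]C[k+1] n k) ⟩
    + (suc n C suc k)             ∎

  ΣS-⊆-size : ∀ {n} (X : Subset n) k
            → ΣS (λ Y → 𝟙 ((Y ⊆ᵇ X) ∧ (∣ Y ∣ ℕ.≡ᵇ k))) ≡ + (∣ X ∣ C k)
  ΣS-⊆-size []            zero    = refl
  ΣS-⊆-size []            (suc k) = refl
  ΣS-⊆-size {suc n} (inside ∷ X) zero = begin
    ΣS {suc n} (λ Y → 𝟙 ((Y ⊆ᵇ inside ∷ X) ∧ (∣ Y ∣ ℕ.≡ᵇ 0)))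
      ≡⟨ ΣS-suc {n} (λ Y → 𝟙 ((Y ⊆ᵇ inside ∷ X) ∧ (∣ Y ∣ ℕ.≡ᵇ 0))) ⟩
    ΣS {n} (λ Y → 𝟙 ((Y ⊆ᵇ X) ∧ false)) + ΣS {n} (λ Y → 𝟙 ((Y ⊆ᵇ X) ∧ (∣ Y ∣ ℕ.≡ᵇ 0)))
      ≡⟨ cong₂ _+_ (Σ-zero _ (allSubsets n) (λ Y → 𝟙-∧-false (Y ⊆ᵇ X))) (ΣS-⊆-size X 0) ⟩
    0ℤ + + (∣ X ∣ C 0) ∎
  ΣS-⊆-size {suc n} (inside ∷ X) (suc k) = begin
    ΣS {suc n} (λ Y → 𝟙 ((Y ⊆ᵇ inside ∷ X) ∧ (∣ Y ∣ ℕ.≡ᵇ suc k)))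
      ≡⟨ ΣS-suc {n} (λ Y → 𝟙 ((Y ⊆ᵇ inside ∷ X) ∧ (∣ Y ∣ ℕ.≡ᵇ suc k))) ⟩
    ΣS {n} (λ Y → 𝟙 ((Y ⊆ᵇ X) ∧ (∣ Y ∣ ℕ.≡ᵇ k))) + ΣS {n} (λ Y → 𝟙 ((Y ⊆ᵇ X) ∧ (∣ Y ∣ ℕ.≡ᵇ suc k)))
      ≡⟨ cong₂ _+_ (ΣS-⊆-size X k) (ΣS-⊆-size X (suc k)) ⟩
    + (∣ X ∣ C k) + + (∣ X ∣ C suc k)   ≡⟨ sym (ℤP.pos-+ (∣ X ∣ C k) (∣ X ∣ C suc k)) ⟩
    + (∣ X ∣ C k ℕ.+ ∣ X ∣ C suc k)     ≡⟨ cong +_ (nCk+nC[k+1]≡[n+1]C[k+1] ∣ X ∣ k) ⟩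
    + (suc ∣ X ∣ C suc k)               ∎
  ΣS-⊆-size {suc n} (outside ∷ X) k = begin
    ΣS {suc n} (λ Y → 𝟙 ((Y ⊆ᵇ outside ∷ X) ∧ (∣ Y ∣ ℕ.≡ᵇ k)))
      ≡⟨ ΣS-suc {n} (λ Y → 𝟙 ((Y ⊆ᵇ outside ∷ X) ∧ (∣ Y ∣ ℕ.≡ᵇ k))) ⟩
    ΣS {n} (λ _ → 0ℤ) + ΣS {n} (λ Y → 𝟙 ((Y ⊆ᵇ X) ∧ (∣ Y ∣ ℕ.≡ᵇ k)))
      ≡⟨ cong₂ _+_ (Σ-zero _ (allSubsets n) (λ _ → refl)) (ΣS-⊆-size X k) ⟩
    0ℤ + + (∣ X ∣ C k)                  ≡⟨ ℤP.+-identityˡ _ ⟩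
    + (∣ X ∣ C k)                       ∎

module Flats {n : ℕ} (M : Matroid n) where

  open import Data.Nat using (zero; suc; _≤_; z≤n; s≤s)
  import Data.Nat.Properties as ℕP
  open import Data.Bool using (Bool; true; false; _∧_; _∨_; not; T)
  open import Data.Fin using (Fin)
  open import Data.Fin.Subset
  open import Data.Fin.Subset.Properties
  open import Data.List using (allFin)
  open import Data.List.Membership.Propositional.Properties using (∈-allFin)
  open import Data.Product using (Σ; _×_; _,_)
  open import Data.Empty using (⊥-elim)
  open import Data.Unit using (tt)
  open import Relation.Nullary using (¬_; yes; no)
  open import Relation.Nullary.Decidable using (⌊_⌋; toWitness; fromWitness; toWitnessFalse; fromWitnessFalse)
  open import Relation.Binary.PropositionalEquality
  open import Data.Vec.Properties using (≡-dec)
  import Data.Bool.Properties as BoolP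
  open Booleans
  open Subsets

  flat-elim : ∀ {X} → IsFlat M X → ∀ e → e ∉ X → ¬ rk M (X ∪ ⁅ e ⁆) ≡ rk M X
  flat-elim {X} flat e e∉X eq = test (allᵇ-elim _ (allFin n) flat e (∈-allFin e))
    where
    test : ¬ T (⌊ e ∈? X ⌋ ∨ not (rk M (X ∪ ⁅ e ⁆) ℕ.≡ᵇ rk M X))
    test t with e ∈? X
    ... | yes e∈X = e∉X e∈X
    ... | no  _   = not-T (rk M (X ∪ ⁅ e ⁆) ℕ.≡ᵇ rk M X) t (ℕP.≡⇒≡ᵇ _ _ eq)

  flat-intro : ∀ X → (∀ e → e ∉ X → ¬ rk M (X ∪ ⁅ e ⁆) ≡ rk M X) → IsFlat M X
  flat-intro X raises = allᵇ-intro _ (allFin n) test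
    where
    test : ∀ e → T (⌊ e ∈? X ⌋ ∨ not (rk M (X ∪ ⁅ e ⁆) ℕ.≡ᵇ rk M X))
    test e with e ∈? X
    ... | yes _   = tt
    ... | no  e∉X with rk M (X ∪ ⁅ e ⁆) ℕ.≡ᵇ rk M X in same
    ...   | true  = raises e e∉X (ℕP.≡ᵇ⇒≡ _ _ (subst T (sym same) tt))
    ...   | false = tt

  not-flat : ∀ X → ¬ IsFlat M X → Σ (Fin n) λ e → e ∉ X × rk M (X ∪ ⁅ e ⁆) ≡ rk M X
  not-flat X h with allᵇ-counterexample _ (allFin n) h
  ... | e , fails with e ∈? X | rk M (X ∪ ⁅ e ⁆) ℕ.≡ᵇ rk M X in same
  ...   | yes _   | _     = ⊥-elim (fails tt)
  ...   | no  e∉X | true  = e , e∉X , ℕP.≡ᵇ⇒≡ _ _ (subst T (sym same) tt)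
  ...   | no  _   | false = ⊥-elim (fails tt)

  rk-∅ : rk M ⊥ ≡ 0
  rk-∅ = ℕP.n≤0⇒n≡0 (ℕP.≤-trans (rk-card M ⊥) (ℕP.≤-reflexive (∣⊥∣≡0 n)))

  rk≤rank : ∀ X → rk M X ≤ rank M
  rk≤rank X = rk-mono M ⊆⊤

  flat-maximal : ∀ {X Y} → IsFlat M X → X ⊆ Y → rk M Y ≤ rk M X → Y ⊆ X
  flat-maximal {X} {Y} flat X⊆Y rkY≤rkX {e} e∈Y with e ∈? X
  ... | yes e∈X = e∈X
  ... | no  e∉X = ⊥-elim (flat-elim flat e e∉X (ℕP.≤-antisym
          (ℕP.≤-trans (rk-mono M (∪-⊆ X⊆Y (⁅⁆-⊆ e∈Y))) rkY≤rkX)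
          (rk-mono M (p⊆p∪q ⁅ e ⁆))))

  ⊤-flat : IsFlat M ⊤
  ⊤-flat = flat-intro ⊤ λ e e∉⊤ _ → e∉⊤ ∈⊤

  proper-elim : ∀ {Y X} → T (properSubᵇ M Y X) → Y ⊆ X × ¬ Y ≡ X
  proper-elim {Y} {X} t = toWitness {a? = Y ⊆? X} (∧-fst t)
                         , toWitnessFalse {a? = ≡-dec BoolP._≟_ Y X} (∧-snd {⌊ Y ⊆? X ⌋} t)

  proper-intro : ∀ {Y X} → Y ⊆ X → ¬ Y ≡ X → T (properSubᵇ M Y X)
  proper-intro {Y} {X} Y⊆X Y≢X = ∧-intro (fromWitness {a? = Y ⊆? X} Y⊆X)
                                         (fromWitnessFalse {a? = ≡-dec BoolP._≟_ Y X} Y≢X)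

  -- Closure: every set lies in a flat of the same rank (add elements that do
  -- not raise the rank until none is left; k bounds the number of steps).
  closure-within : ∀ k Z → n ≤ ∣ Z ∣ ℕ.+ k → Σ (Subset n) λ L → IsFlat M L × Z ⊆ L × rk M L ≡ rk M Z
  closure-within k Z room with isFlatᵇ M Z in flatness
  ... | true  = Z , subst T (sym flatness) tt , (λ p → p) , refl
  ... | false with not-flat Z (λ t → subst T flatness t)
  ...   | e , e∉Z , same-rank with k
  ...     | zero = ⊥-elim (ℕP.<-irrefl refl (ℕP.≤-trans (s≤s full) (ℕP.≤-trans
                     (ℕP.≤-reflexive (sym (size-∪-new Z e e∉Z))) (∣p∣≤n (Z ∪ ⁅ e ⁆)))))
    where
    full : n ≤ ∣ Z ∣
    full = ℕP.≤-trans room (ℕP.≤-reflexive (ℕP.+-identityʳ _))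
  ...     | suc k′ with closure-within k′ (Z ∪ ⁅ e ⁆) (ℕP.≤-trans room (ℕP.≤-reflexive
                         (trans (ℕP.+-suc ∣ Z ∣ k′) (cong (ℕ._+ k′) (sym (size-∪-new Z e e∉Z))))))
  ...       | L , flat , Z+e⊆L , rkL = L , flat , (λ p → Z+e⊆L (p⊆p∪q ⁅ e ⁆ p)) , trans rkL same-rank

  closure : ∀ Z → Σ (Subset n) λ L → IsFlat M L × Z ⊆ L × rk M L ≡ rk M Z
  closure Z = closure-within n Z (ℕP.m≤n+m n ∣ Z ∣)

  isLineᵇ : Subset n → Bool
  isLineᵇ X = isFlatᵇ M X ∧ (rk M X ℕ.≡ᵇ 2)

  IsLine : Subset n → Set
  IsLine X = T (isLineᵇ X)

  line-flat : ∀ {X} → IsLine X → IsFlat M X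
  line-flat = ∧-fst

  line-rk : ∀ {X} → IsLine X → rk M X ≡ 2
  line-rk {X} t = ℕP.≡ᵇ⇒≡ _ _ (∧-snd {isFlatᵇ M X} t)

  mk-line : ∀ {X} → IsFlat M X → rk M X ≡ 2 → IsLine X
  mk-line flat rk≡2 = ∧-intro flat (ℕP.≡⇒≡ᵇ _ _ rk≡2)

  line-size≥2 : ∀ {X} → IsLine X → 2 ≤ ∣ X ∣
  line-size≥2 {X} t = ℕP.≤-trans (ℕP.≤-reflexive (sym (line-rk t))) (rk-card M X)

  small≢line : ∀ {X L} → IsLine L → ∣ X ∣ ≤ 1 → ¬ X ≡ L
  small≢line {X} line |X|≤1 refl with ℕP.≤-trans (line-size≥2 line) |X|≤1
  ... | s≤s ()

  ∅≢line : ∀ {L} → IsLine L → ¬ ⊥ ≡ L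
  ∅≢line line = small≢line line (ℕP.≤-trans (ℕP.≤-reflexive (∣⊥∣≡0 n)) z≤n)

  -- By submodularity, a set of rank ≤ 2 sharing a rank-2 subset with a line
  -- lies in that line.
  within-line : ∀ L X → IsLine L → rk M X ≤ 2 → 2 ≤ rk M (L ∩ X) → X ⊆ L
  within-line L X line rkX≤2 2≤rk∩ e∈X = flat-maximal (line-flat line) (p⊆p∪q X) rk∪≤rkL (q⊆p∪q L X e∈X)
    where
    rk∪≤rkL : rk M (L ∪ X) ≤ rk M L
    rk∪≤rkL = ℕP.+-cancelʳ-≤ 2 (rk M (L ∪ X)) (rk M L)
      (ℕP.≤-trans (ℕP.+-monoʳ-≤ (rk M (L ∪ X)) 2≤rk∩)
      (ℕP.≤-trans (rk-submod M L X) (ℕP.+-monoʳ-≤ (rk M L) rkX≤2)))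

module SimpleMatroid {n : ℕ} (M : Matroid n) (simple : IsSimple M) where

  open import Data.Nat using (suc; _≤_; z≤n; s≤s)
  import Data.Nat.Properties as ℕP
  open import Data.Bool using (true; false; _∨_; not; T)
  open import Data.Fin.Subset
  open import Data.Fin.Subset.Properties
  open import Data.Product using (Σ; _×_; _,_; proj₁; proj₂)
  open import Data.Sum using (inj₁; inj₂)
  open import Data.Empty using (⊥-elim)
  open import Data.Unit using (tt)
  open import Relation.Nullary using (¬_; yes; no)
  open import Relation.Binary.PropositionalEquality
  open Booleans
  open Subsets
  open Flats M

  rk-point : ∀ e → rk M ⁅ e ⁆ ≡ 1
  rk-point = proj₁ simple

  rk-pair : ∀ e f → ¬ e ≡ f → rk M (⁅ e ⁆ ∪ ⁅ f ⁆) ≡ 2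
  rk-pair = proj₂ simple

  rk≥1 : ∀ {X e} → e ∈ X → 1 ≤ rk M X
  rk≥1 {X} {e} e∈X = ℕP.≤-trans (ℕP.≤-reflexive (sym (rk-point e))) (rk-mono M (⁅⁆-⊆ e∈X))

  rk≥2 : ∀ {X e f} → e ∈ X → f ∈ X → ¬ e ≡ f → 2 ≤ rk M X
  rk≥2 {X} {e} {f} e∈X f∈X e≢f =
    ℕP.≤-trans (ℕP.≤-reflexive (sym (rk-pair e f e≢f))) (rk-mono M (∪-⊆ (⁅⁆-⊆ e∈X) (⁅⁆-⊆ f∈X)))

  rk-small : ∀ D → ∣ D ∣ ≤ 2 → rk M D ≡ ∣ D ∣
  rk-small D h with ∣ D ∣ in size
  ... | 0 = ℕP.n≤0⇒n≡0 (ℕP.≤-trans (rk-card M D) (ℕP.≤-reflexive size))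
  ... | 1 with element D (ℕP.≤-reflexive (sym size))
  ...   | e , e∈D = ℕP.≤-antisym (ℕP.≤-trans (rk-card M D) (ℕP.≤-reflexive size)) (rk≥1 e∈D)
  rk-small D h | 2 with two-elements D (ℕP.≤-reflexive (sym size))
  ...   | e , f , e∈D , f∈D , e≢f =
    ℕP.≤-antisym (ℕP.≤-trans (rk-card M D) (ℕP.≤-reflexive size)) (rk≥2 e∈D f∈D e≢f)
  rk-small D (s≤s (s≤s ())) | suc (suc (suc _))

  rk-0 : ∀ X → rk M X ≡ 0 → X ≡ ⊥
  rk-0 X h with nonempty? X
  ... | no  empty = Empty-unique empty
  ... | yes (e , e∈X) with rk≥1 e∈X
  ...   | 1≤rk rewrite h with 1≤rk
  ...     | ()

  rk-1-size : ∀ X → rk M X ≡ 1 → ∣ X ∣ ≡ 1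
  rk-1-size X h with ∣ X ∣ in size
  ... | 0 = ⊥-elim (ℕP.<-irrefl refl
          (ℕP.≤-trans (ℕP.≤-reflexive (sym h)) (ℕP.≤-trans (rk-card M X) (ℕP.≤-reflexive size))))
  ... | 1 = refl
  ... | suc (suc k) with two-elements X (ℕP.≤-trans (s≤s (s≤s z≤n)) (ℕP.≤-reflexive (sym size)))
  ...   | e , f , e∈X , f∈X , e≢f = ⊥-elim (ℕP.<-irrefl refl (ℕP.≤-trans (rk≥2 e∈X f∈X e≢f) (ℕP.≤-reflexive h)))

  ∅-flat : IsFlat M ⊥
  ∅-flat = flat-intro ⊥ λ e _ eq → 1≢0 (begin
    1                 ≡⟨ sym (rk-point e) ⟩
    rk M ⁅ e ⁆         ≡⟨ cong (rk M) (sym (∪-identityˡ ⁅ e ⁆)) ⟩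
    rk M (⊥ ∪ ⁅ e ⁆)   ≡⟨ eq ⟩
    rk M ⊥            ≡⟨ rk-∅ ⟩
    0                 ∎)
    where
    open ≡-Reasoning
    1≢0 : ¬ 1 ≡ 0
    1≢0 ()

  point-flat : ∀ e → IsFlat M ⁅ e ⁆
  point-flat e = flat-intro ⁅ e ⁆ λ f f∉e eq →
    1≢2 (trans (sym (rk-point e)) (trans (sym eq) (rk-pair e f (λ e≡f → f∉e (subst (_∈ ⁅ e ⁆) e≡f (x∈⁅x⁆ e))))))
    where
    1≢2 : ¬ 1 ≡ 2
    1≢2 ()

  line-through : ∀ Y → ∣ Y ∣ ≡ 2 → Σ (Subset n) λ L → IsLine L × Y ⊆ L
  line-through Y size with closure Y
  ... | L , flat , Y⊆L , rkL = L , mk-line flat (trans rkL (trans (rk-small Y (ℕP.≤-reflexive size)) size)) , Y⊆L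

  line-unique : ∀ Y L X → ∣ Y ∣ ≡ 2 → IsLine L → Y ⊆ L → IsLine X → Y ⊆ X → X ≡ L
  line-unique Y L X size lineL Y⊆L lineX Y⊆X =
    ⊆-antisym (within-line L X lineL (ℕP.≤-reflexive (line-rk lineX)) (shared L X Y⊆L Y⊆X))
              (within-line X L lineX (ℕP.≤-reflexive (line-rk lineL)) (shared X L Y⊆X Y⊆L))
    where
    shared : ∀ A B → Y ⊆ A → Y ⊆ B → 2 ≤ rk M (A ∩ B)
    shared A B Y⊆A Y⊆B = ℕP.≤-trans (ℕP.≤-reflexive (sym (trans (rk-small Y (ℕP.≤-reflexive size)) size)))
                                    (rk-mono M (λ p → x∈p∩q⁺ (Y⊆A p , Y⊆B p)))

  -- A three-point line is a circuit: it is dependent, and its proper subsets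
  -- have at most two elements, hence are independent.
  line⇒circuit : ∀ X → ∣ X ∣ ≡ 3 → IsLine X → T (isCircuitᵇ M X)
  line⇒circuit X size line = ∧-intro dependent (allᵇ-intro _ (allSubsets n) proper-independent)
    where
    dependent : T (not (rk M X ℕ.≡ᵇ ∣ X ∣))
    dependent with rk M X ℕ.≡ᵇ ∣ X ∣ in eq
    ... | false = tt
    ... | true  = 2≢3 (trans (sym (line-rk line)) (trans (ℕP.≡ᵇ⇒≡ _ _ (subst T (sym eq) tt)) size))
      where
      2≢3 : ¬ 2 ≡ 3
      2≢3 ()
    proper-independent : ∀ D → T (not (properSubᵇ M D X) ∨ (rk M D ℕ.≡ᵇ ∣ D ∣))
    proper-independent D with properSubᵇ M D X in eq
    ... | false = tt
    ... | true with proper-elim {D} {X} (subst T (sym eq) tt)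
    ...   | D⊆X , D≢X = ℕP.≡⇒≡ᵇ _ _ (rk-small D
              (ℕP.≤-pred (ℕP.≤-trans (proper-size D X D⊆X D≢X) (ℕP.≤-reflexive size))))

  -- A proper subflat of a line has at most one element: two distinct points
  -- already span the line.
  proper-subflat-of-line : ∀ {L Y} → IsLine L → IsFlat M Y → Y ⊆ L → ¬ Y ≡ L → ∣ Y ∣ ≤ 1
  proper-subflat-of-line {L} {Y} line flat Y⊆L Y≢L with ℕP.≤-<-connex ∣ Y ∣ 1
  ... | inj₁ ≤1 = ≤1
  ... | inj₂ >1 with two-elements Y >1
  ...   | e , f , e∈Y , f∈Y , e≢f = ⊥-elim (Y≢L (⊆-antisym Y⊆L (flat-maximal flat Y⊆L
          (ℕP.≤-trans (ℕP.≤-reflexive (line-rk line)) (rk≥2 e∈Y f∈Y e≢f)))))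

module Möbius {n : ℕ} (M : Matroid n) (simple : IsSimple M) where

  open import Data.Nat using (suc; _≤_; _<_; s≤s)
  import Data.Nat.Properties as ℕP
  open import Data.Integer using (ℤ; +_; -_; _+_; _*_; _-_; 0ℤ; 1ℤ)
  import Data.Integer.Properties as ℤP
  open import Data.Bool using (Bool; true; false; _∧_; if_then_else_; T)
  open import Data.Bool.Properties using (T?)
  open import Data.Fin using (Fin)
  open import Data.Fin.Subset hiding (_-_)
  open import Data.Fin.Subset.Properties
  open import Data.Vec.Properties using (≡-dec)
  import Data.Bool.Properties as BoolP
  open import Data.List using (List; map; filter)
  open import Data.List.Membership.Propositional using () renaming (_∈_ to _∈ₗ_)
  open import Data.List.Membership.Propositional.Properties using (∈-filter⁻)
  open import Data.Product using (_,_; proj₁; proj₂)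
  open import Function.Bundles using (Equivalence)
  open import Data.Empty using (⊥-elim)
  open import Data.Unit using (tt)
  open import Relation.Nullary using (¬_)
  open import Relation.Nullary.Decidable using (fromWitness; fromWitnessFalse)
  open import Relation.Binary.PropositionalEquality
  open import Data.Nat.Combinatorics using (_C_; nC1≡n)
  open import Data.Integer.Tactic.RingSolver using (solve-∀)
  open ≡-Reasoning
  open Polynomial using (Σℤ)
  open Booleans
  open Subsets
  open FiniteSums
  open Flats M
  open SimpleMatroid M simple

  flats-below : Subset n → List (Subset n)
  flats-below X = filter (λ Y → T? (properSubᵇ M Y X)) (flats M)

  below-smaller : ∀ X Y → Y ∈ₗ flats-below X → ∣ Y ∣ < ∣ X ∣
  below-smaller X Y Y∈
    with proper-elim {Y} {X} (proj₂ (∈-filter⁻ (λ Y → T? (properSubᵇ M Y X)) {xs = flats M} Y∈))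
  ... | Y⊆X , Y≢X = proper-size Y X Y⊆X Y≢X

  fuel-irrelevant : ∀ k j X → ∣ X ∣ < k → ∣ X ∣ < j → mobF M k X ≡ mobF M j X
  fuel-irrelevant (suc k) (suc j) X (s≤s |X|≤k) (s≤s |X|≤j) with isEmptyᵇ M X
  ... | true  = refl
  ... | false = cong -_ (Σ-cong (flats-below X) λ Y Y∈ →
      fuel-irrelevant k j Y (ℕP.<-≤-trans (below-smaller X Y Y∈) |X|≤k)
                            (ℕP.<-≤-trans (below-smaller X Y Y∈) |X|≤j))

  isEmpty-∅ : isEmptyᵇ M ⊥ ≡ true
  isEmpty-∅ = Equivalence.to BoolP.T-≡ (fromWitness {a? = ≡-dec BoolP._≟_ ⊥ ⊥} refl)

  isEmpty-nonempty : ∀ X → ¬ X ≡ ⊥ → isEmptyᵇ M X ≡ false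
  isEmpty-nonempty X X≢∅ = Equivalence.to BoolP.T-not-≡ (fromWitnessFalse {a? = ≡-dec BoolP._≟_ X ⊥} X≢∅)

  μ∅ : μ M ⊥ ≡ 1ℤ
  μ∅ = cong (λ b → if b then 1ℤ else - Σℤ (map (mobF M n) (flats-below ⊥))) isEmpty-∅

  μ-rec : ∀ X → ¬ X ≡ ⊥ → μ M X ≡ - ΣS (λ Y → 𝟙 (isFlatᵇ M Y ∧ properSubᵇ M Y X) * μ M Y)
  μ-rec X X≢∅ = begin
    mobF M (suc n) X
      ≡⟨ cong (λ b → if b then 1ℤ else - Σℤ (map (mobF M n) (flats-below X))) (isEmpty-nonempty X X≢∅) ⟩
    - Σℤ (map (mobF M n) (flats-below X))
      ≡⟨ cong -_ (Σ-cong (flats-below X) (λ Y Y∈ → fuel-irrelevant n (suc n) Y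
           (ℕP.<-≤-trans (below-smaller X Y Y∈) (∣p∣≤n X))
           (ℕP.<-≤-trans (below-smaller X Y Y∈) (ℕP.m≤n⇒m≤1+n (∣p∣≤n X))))) ⟩
    - Σℤ (map (μ M) (flats-below X))
      ≡⟨ cong -_ (Σ-filter (λ Y → properSubᵇ M Y X) (μ M) (flats M)) ⟩
    - Σℤ (map (λ Y → 𝟙 (properSubᵇ M Y X) * μ M Y) (flats M))
      ≡⟨ cong -_ (Σ-filter (isFlatᵇ M) (λ Y → 𝟙 (properSubᵇ M Y X) * μ M Y) (allSubsets n)) ⟩
    - ΣS (λ Y → 𝟙 (isFlatᵇ M Y) * (𝟙 (properSubᵇ M Y X) * μ M Y))
      ≡⟨ cong -_ (Σ-cong (allSubsets n) (λ Y _ → begin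
           𝟙 (isFlatᵇ M Y) * (𝟙 (properSubᵇ M Y X) * μ M Y)
             ≡⟨ sym (ℤP.*-assoc (𝟙 (isFlatᵇ M Y)) _ _) ⟩
           𝟙 (isFlatᵇ M Y) * 𝟙 (properSubᵇ M Y X) * μ M Y
             ≡⟨ cong (_* μ M Y) (sym (𝟙-∧ (isFlatᵇ M Y) _)) ⟩
           𝟙 (isFlatᵇ M Y ∧ properSubᵇ M Y X) * μ M Y ∎)) ⟩
    - ΣS (λ Y → 𝟙 (isFlatᵇ M Y ∧ properSubᵇ M Y X) * μ M Y) ∎

  point≢∅ : ∀ (e : Fin n) → ¬ ⁅ e ⁆ ≡ ⊥
  point≢∅ e eq = ∉⊥ (subst (e ∈_) eq (x∈⁅x⁆ e))

  -- μ(point) = -1: the only flat below a point is ∅.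
  μ-point : ∀ e → μ M ⁅ e ⁆ ≡ - 1ℤ
  μ-point e = begin
    μ M ⁅ e ⁆   ≡⟨ μ-rec ⁅ e ⁆ (point≢∅ e) ⟩
    - ΣS (λ Y → 𝟙 (below Y) * μ M Y)
                ≡⟨ cong -_ (ΣS-unique below (μ M) ⊥ only-∅ ∅-below) ⟩
    - μ M ⊥     ≡⟨ cong -_ μ∅ ⟩
    - 1ℤ        ∎
    where
    below : Subset n → Bool
    below Y = isFlatᵇ M Y ∧ properSubᵇ M Y ⁅ e ⁆
    ∅-below : T (below ⊥)
    ∅-below = ∧-intro ∅-flat (proper-intro ⊥⊆ (λ eq → point≢∅ e (sym eq)))
    only-∅ : ∀ Y → T (below Y) → Y ≡ ⊥
    only-∅ Y t with proper-elim {Y} {⁅ e ⁆} (∧-snd {isFlatᵇ M Y} t)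
    ... | Y⊆e , Y≢e = size-0 Y (ℕP.n≤0⇒n≡0 (ℕP.≤-pred
          (ℕP.≤-trans (proper-size Y ⁅ e ⁆ Y⊆e Y≢e) (ℕP.≤-reflexive (∣⁅x⁆∣≡1 e)))))

  ∅-below-line : ∀ {L} → IsLine L → isFlatᵇ M ⊥ ∧ properSubᵇ M ⊥ L ≡ true
  ∅-below-line line = Equivalence.to BoolP.T-≡ (∧-intro ∅-flat (proper-intro ⊥⊆ (∅≢line line)))

  point-below-line : ∀ {L} → IsLine L → ∀ e
                   → isFlatᵇ M ⁅ e ⁆ ∧ properSubᵇ M ⁅ e ⁆ L ≡ ((⁅ e ⁆ ⊆ᵇ L) ∧ true)
  point-below-line {L} line e = T-ext
    (λ t → ∧-intro (⊆ᵇ-complete ⁅ e ⁆ L (proj₁ (proper-elim (∧-snd {isFlatᵇ M ⁅ e ⁆} t)))) tt)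
    (λ t → ∧-intro (point-flat e) (proper-intro (⊆ᵇ-sound ⁅ e ⁆ L (∧-fst t))
      (small≢line line (ℕP.≤-reflexive (∣⁅x⁆∣≡1 e)))))

  line-summand : ∀ L → IsLine L → ∀ Y → 𝟙 (isFlatᵇ M Y ∧ properSubᵇ M Y L) * μ M Y
               ≡ 𝟙 (∣ Y ∣ ℕ.≡ᵇ 0) + - 1ℤ * 𝟙 ((Y ⊆ᵇ L) ∧ (∣ Y ∣ ℕ.≡ᵇ 1))
  line-summand L line Y with ∣ Y ∣ in size
  ... | 0 = begin
    𝟙 (isFlatᵇ M Y ∧ properSubᵇ M Y L) * μ M Y  ≡⟨ cong summand (size-0 Y size) ⟩
    𝟙 (isFlatᵇ M ⊥ ∧ properSubᵇ M ⊥ L) * μ M ⊥  ≡⟨ cong₂ (λ b m → 𝟙 b * m) (∅-below-line line) μ∅ ⟩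
    1ℤ                                         ≡⟨ cong (λ u → 1ℤ + - 1ℤ * u) (sym (𝟙-∧-false (Y ⊆ᵇ L))) ⟩
    1ℤ + - 1ℤ * 𝟙 ((Y ⊆ᵇ L) ∧ false)           ∎
    where
    summand : Subset n → ℤ
    summand Z = 𝟙 (isFlatᵇ M Z ∧ properSubᵇ M Z L) * μ M Z
  ... | 1 with size-1 Y size
  ...   | e , refl = begin
    𝟙 (isFlatᵇ M ⁅ e ⁆ ∧ properSubᵇ M ⁅ e ⁆ L) * μ M ⁅ e ⁆
      ≡⟨ cong₂ (λ b m → 𝟙 b * m) (point-below-line line e) (μ-point e) ⟩
    𝟙 ((⁅ e ⁆ ⊆ᵇ L) ∧ true) * - 1ℤ
      ≡⟨ ℤP.*-comm (𝟙 ((⁅ e ⁆ ⊆ᵇ L) ∧ true)) (- 1ℤ) ⟩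
    - 1ℤ * 𝟙 ((⁅ e ⁆ ⊆ᵇ L) ∧ true)
      ≡⟨ sym (ℤP.+-identityˡ _) ⟩
    0ℤ + - 1ℤ * 𝟙 ((⁅ e ⁆ ⊆ᵇ L) ∧ true) ∎
  line-summand L line Y | suc (suc k) with isFlatᵇ M Y ∧ properSubᵇ M Y L in below
  ... | false = sym (cong (λ u → 0ℤ + - 1ℤ * u) (𝟙-∧-false (Y ⊆ᵇ L)))
  ... | true  with proper-elim {Y} {L} (∧-snd {isFlatᵇ M Y} (subst T (sym below) tt))
  ...   | Y⊆L , Y≢L = ⊥-elim (too-big (ℕP.≤-trans (ℕP.≤-reflexive (sym size))
            (proper-subflat-of-line line (∧-fst (subst T (sym below) tt)) Y⊆L Y≢L)))
    where
    too-big : ¬ suc (suc k) ≤ 1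
    too-big (s≤s ())

  μ-line : ∀ L → IsLine L → μ M L ≡ + ∣ L ∣ - 1ℤ
  μ-line L line = begin
    μ M L
      ≡⟨ μ-rec L L≢∅ ⟩
    - ΣS (λ Y → 𝟙 (isFlatᵇ M Y ∧ properSubᵇ M Y L) * μ M Y)
      ≡⟨ cong -_ (Σ-cong (allSubsets n) (λ Y _ → line-summand L line Y)) ⟩
    - ΣS (λ Y → 𝟙 (∣ Y ∣ ℕ.≡ᵇ 0) + - 1ℤ * 𝟙 ((Y ⊆ᵇ L) ∧ (∣ Y ∣ ℕ.≡ᵇ 1)))
      ≡⟨ cong -_ (Σ-+ (λ Y → 𝟙 (∣ Y ∣ ℕ.≡ᵇ 0)) (λ Y → - 1ℤ * 𝟙 ((Y ⊆ᵇ L) ∧ (∣ Y ∣ ℕ.≡ᵇ 1))) (allSubsets n)) ⟩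
    - (ΣS {n} (λ Y → 𝟙 (∣ Y ∣ ℕ.≡ᵇ 0)) + ΣS (λ Y → - 1ℤ * 𝟙 ((Y ⊆ᵇ L) ∧ (∣ Y ∣ ℕ.≡ᵇ 1))))
      ≡⟨ cong (λ u → - (ΣS {n} (λ Y → 𝟙 (∣ Y ∣ ℕ.≡ᵇ 0)) + u))
              (Σ-scale (- 1ℤ) (λ Y → 𝟙 ((Y ⊆ᵇ L) ∧ (∣ Y ∣ ℕ.≡ᵇ 1))) (allSubsets n)) ⟩
    - (ΣS {n} (λ Y → 𝟙 (∣ Y ∣ ℕ.≡ᵇ 0)) + - 1ℤ * ΣS (λ Y → 𝟙 ((Y ⊆ᵇ L) ∧ (∣ Y ∣ ℕ.≡ᵇ 1))))
      ≡⟨ cong₂ (λ u v → - (u + - 1ℤ * v)) (ΣS-size n 0) (ΣS-⊆-size L 1) ⟩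
    - (1ℤ + - 1ℤ * + (∣ L ∣ C 1))
      ≡⟨ cong (λ k → - (1ℤ + - 1ℤ * + k)) (nC1≡n ∣ L ∣) ⟩
    - (1ℤ + - 1ℤ * + ∣ L ∣)
      ≡⟨ simplify (+ ∣ L ∣) ⟩
    + ∣ L ∣ - 1ℤ ∎
    where
    simplify : ∀ (c : ℤ) → - (1ℤ + - 1ℤ * c) ≡ c - 1ℤ
    simplify = solve-∀
    L≢∅ : ¬ L ≡ ⊥
    L≢∅ L≡∅ = ∅≢line line (sym L≡∅)

module CharPoly {n : ℕ} (M : Matroid n) (simple : IsSimple M) where

  open import Data.Nat using (zero; suc; _≤_; z≤n; s≤s; _∸_)
  import Data.Nat.Properties as ℕP
  open import Data.Integer using (ℤ; +_; -_; _+_; _*_; _-_; _^_; 0ℤ; 1ℤ)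
  import Data.Integer.Properties as ℤP
  open import Data.Bool using (Bool; true; false; _∧_; if_then_else_; T)
  import Data.Bool.Properties as BoolP
  open import Data.Fin.Subset hiding (_-_)
  open import Data.Fin.Subset.Properties
  open import Data.List using (map)
  open import Data.Product using (Σ; _,_)
  open import Data.Vec.Properties using (≡-dec)
  open import Relation.Nullary.Decidable using (⌊_⌋; yes; no; toWitness; fromWitness)
  open import Data.Fin using (Fin)
  open import Data.Empty using (⊥-elim)
  open import Data.Unit using (tt)
  open import Relation.Nullary using (¬_)
  open import Relation.Binary.PropositionalEquality
  open import Function.Bundles using (Equivalence)
  open import Data.Nat.Combinatorics using (_C_; nC1≡n)
  open ≡-Reasoning
  open Polynomial
  open Booleans
  open Subsets
  open FiniteSums
  open Flats M
  open SimpleMatroid M simple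
  open Möbius M simple

  r : ℕ
  r = rank M

  χ-poly : Poly
  χ-poly = ⨁ (λ X → monomial (μ M X) (r ∸ rk M X)) (flats M)

  eval-χ-poly : ∀ x → χ M x ≡ eval χ-poly x
  eval-χ-poly x = sym (begin
    eval χ-poly x
      ≡⟨ eval-⨁ (λ X → monomial (μ M X) (r ∸ rk M X)) (flats M) x ⟩
    Σℤ (map (λ X → eval (monomial (μ M X) (r ∸ rk M X)) x) (flats M))
      ≡⟨ Σ-cong (flats M) (λ X _ → eval-monomial (μ M X) (r ∸ rk M X) x) ⟩
    χ M x ∎)

  coeff-χ-poly : ∀ k → coeff χ-poly k
               ≡ ΣS (λ X → 𝟙 (isFlatᵇ M X) * (if k ℕ.≡ᵇ (r ∸ rk M X) then μ M X else 0ℤ))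
  coeff-χ-poly k = begin
    coeff χ-poly k
      ≡⟨ coeff-⨁ (λ X → monomial (μ M X) (r ∸ rk M X)) (flats M) k ⟩
    Σℤ (map (λ X → coeff (monomial (μ M X) (r ∸ rk M X)) k) (flats M))
      ≡⟨ Σ-cong (flats M) (λ X _ → coeff-monomial (μ M X) (r ∸ rk M X) k) ⟩
    Σℤ (map (λ X → if k ℕ.≡ᵇ (r ∸ rk M X) then μ M X else 0ℤ) (flats M))
      ≡⟨ Σ-filter (isFlatᵇ M) (λ X → if k ℕ.≡ᵇ (r ∸ rk M X) then μ M X else 0ℤ) (allSubsets n) ⟩
    ΣS (λ X → 𝟙 (isFlatᵇ M X) * (if k ℕ.≡ᵇ (r ∸ rk M X) then μ M X else 0ℤ)) ∎

  coeff-rank : ∀ j → j ≤ r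
             → coeff χ-poly (r ∸ j) ≡ ΣS (λ X → 𝟙 (isFlatᵇ M X ∧ (rk M X ℕ.≡ᵇ j)) * μ M X)
  coeff-rank j j≤r = trans (coeff-χ-poly (r ∸ j)) (Σ-cong (allSubsets n) (λ X _ → select X))
    where
    -- r - j = r - rk X exactly when rk X = j, since both are at most r.
    same-test : ∀ X → ((r ∸ j) ℕ.≡ᵇ (r ∸ rk M X)) ≡ (rk M X ℕ.≡ᵇ j)
    same-test X = T-ext
      (λ t → ℕP.≡⇒≡ᵇ (rk M X) j (sym (ℕP.∸-cancelˡ-≡ j≤r (rk≤rank X) (ℕP.≡ᵇ⇒≡ (r ∸ j) (r ∸ rk M X) t))))
      (λ t → ℕP.≡⇒≡ᵇ (r ∸ j) (r ∸ rk M X) (cong (r ∸_) (sym (ℕP.≡ᵇ⇒≡ (rk M X) j t))))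
    select : ∀ X → 𝟙 (isFlatᵇ M X) * (if (r ∸ j) ℕ.≡ᵇ (r ∸ rk M X) then μ M X else 0ℤ)
                 ≡ 𝟙 (isFlatᵇ M X ∧ (rk M X ℕ.≡ᵇ j)) * μ M X
    select X rewrite same-test X = combine (isFlatᵇ M X) (rk M X ℕ.≡ᵇ j)
      where
      combine : ∀ a b → 𝟙 a * (if b then μ M X else 0ℤ) ≡ 𝟙 (a ∧ b) * μ M X
      combine a true  = cong (_* μ M X) (cong 𝟙 (sym (BoolP.∧-identityʳ a)))
      combine a false = trans (ℤP.*-zeroʳ (𝟙 a)) (cong (λ b → 𝟙 b * μ M X) (sym (BoolP.∧-zeroʳ a)))

  coeff-above : ∀ j → coeff χ-poly (suc (r ℕ.+ j)) ≡ 0ℤ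
  coeff-above j = trans (coeff-χ-poly _) (Σ-zero _ (allSubsets n) vanish)
    where
    vanish : ∀ X → 𝟙 (isFlatᵇ M X) * (if suc (r ℕ.+ j) ℕ.≡ᵇ (r ∸ rk M X) then μ M X else 0ℤ) ≡ 0ℤ
    vanish X with suc (r ℕ.+ j) ℕ.≡ᵇ (r ∸ rk M X) in eq
    ... | false = ℤP.*-zeroʳ (𝟙 (isFlatᵇ M X))
    ... | true  = ⊥-elim (ℕP.<-irrefl refl (ℕP.≤-trans (s≤s (ℕP.m≤m+n r j))
                    (ℕP.≤-trans (ℕP.≤-reflexive (ℕP.≡ᵇ⇒≡ _ _ (subst T (sym eq) tt))) (ℕP.m∸n≤m r (rk M X)))))

  -- The leading coefficient is μ(∅) = 1, ∅ being the only flat of rank 0.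
  coeff-leading : coeff χ-poly r ≡ 1ℤ
  coeff-leading = begin
    coeff χ-poly r
      ≡⟨ coeff-rank 0 z≤n ⟩
    ΣS (λ X → 𝟙 (isFlatᵇ M X ∧ (rk M X ℕ.≡ᵇ 0)) * μ M X)
      ≡⟨ ΣS-unique (λ X → isFlatᵇ M X ∧ (rk M X ℕ.≡ᵇ 0)) (μ M) ⊥
           (λ X t → rk-0 X (ℕP.≡ᵇ⇒≡ _ _ (∧-snd {isFlatᵇ M X} t)))
           (∧-intro ∅-flat (ℕP.≡⇒≡ᵇ _ _ rk-∅)) ⟩
    μ M ⊥
      ≡⟨ μ∅ ⟩
    1ℤ ∎

  χ-monic : Monic χ-poly r
  χ-monic = record { leading = coeff-leading ; above = coeff-above }

  rank-1-flats : ∀ X → (isFlatᵇ M X ∧ (rk M X ℕ.≡ᵇ 1)) ≡ (∣ X ∣ ℕ.≡ᵇ 1)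
  rank-1-flats X = T-ext
    (λ t → ℕP.≡⇒≡ᵇ _ _ (rk-1-size X (ℕP.≡ᵇ⇒≡ _ _ (∧-snd {isFlatᵇ M X} t))))
    (λ t → point (size-1 X (ℕP.≡ᵇ⇒≡ _ _ t)))
    where
    point : Σ (Fin n) (λ e → X ≡ ⁅ e ⁆) → T (isFlatᵇ M X ∧ (rk M X ℕ.≡ᵇ 1))
    point (e , refl) = ∧-intro (point-flat e) (ℕP.≡⇒≡ᵇ _ _ (rk-point e))

  point-summand : ∀ X → 𝟙 (isFlatᵇ M X ∧ (rk M X ℕ.≡ᵇ 1)) * μ M X ≡ - 1ℤ * 𝟙 (∣ X ∣ ℕ.≡ᵇ 1)
  point-summand X rewrite rank-1-flats X with ∣ X ∣ ℕ.≡ᵇ 1 in size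
  ... | false = refl
  ... | true with size-1 X (ℕP.≡ᵇ⇒≡ _ _ (subst T (sym size) tt))
  ...   | e , refl = trans (ℤP.*-identityˡ _) (μ-point e)

  coeff-below-leading : 1 ≤ r → coeff χ-poly (r ∸ 1) ≡ - + n
  coeff-below-leading 1≤r = begin
    coeff χ-poly (r ∸ 1)
      ≡⟨ coeff-rank 1 1≤r ⟩
    ΣS (λ X → 𝟙 (isFlatᵇ M X ∧ (rk M X ℕ.≡ᵇ 1)) * μ M X)
      ≡⟨ Σ-cong (allSubsets n) (λ X _ → point-summand X) ⟩
    ΣS {n} (λ X → - 1ℤ * 𝟙 (∣ X ∣ ℕ.≡ᵇ 1))
      ≡⟨ Σ-scale (- 1ℤ) (λ X → 𝟙 (∣ X ∣ ℕ.≡ᵇ 1)) (allSubsets n) ⟩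
    - 1ℤ * ΣS {n} (λ X → 𝟙 (∣ X ∣ ℕ.≡ᵇ 1))
      ≡⟨ cong (- 1ℤ *_) (trans (ΣS-size n 1) (cong +_ (nC1≡n n))) ⟩
    - 1ℤ * + n
      ≡⟨ ℤP.-1*i≡-i (+ n) ⟩
    - + n ∎

  -- χ(1) = Σ_{flats} μ = 0 when the ground set is nonempty: the flats are ⊤
  -- and the flats properly below ⊤, whose μ-values sum to -μ(⊤).
  isTopᵇ : Subset n → Bool
  isTopᵇ X = ⌊ ≡-dec BoolP._≟_ X ⊤ ⌋

  -- (Deciding X ≟ ⊤ also decides the inequality test inside properSubᵇ M X ⊤.)
  flat-split : ∀ X → 𝟙 (isFlatᵇ M X) ≡ 𝟙 (isTopᵇ X) + 𝟙 (isFlatᵇ M X ∧ properSubᵇ M X ⊤)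
  flat-split X with ≡-dec BoolP._≟_ X ⊤
  ... | yes refl = begin
    𝟙 (isFlatᵇ M ⊤)                                   ≡⟨ cong 𝟙 (Equivalence.to BoolP.T-≡ ⊤-flat) ⟩
    1ℤ                                                ≡⟨ cong (λ b → 1ℤ + 𝟙 b) (sym not-below) ⟩
    1ℤ + 𝟙 (isFlatᵇ M ⊤ ∧ (⌊ ⊤ {n} ⊆? ⊤ ⌋ ∧ false))       ∎
    where
    not-below : isFlatᵇ M ⊤ ∧ (⌊ ⊤ {n} ⊆? ⊤ ⌋ ∧ false) ≡ false
    not-below = trans (cong (isFlatᵇ M ⊤ ∧_) (BoolP.∧-zeroʳ ⌊ ⊤ {n} ⊆? ⊤ ⌋)) (BoolP.∧-zeroʳ (isFlatᵇ M ⊤))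
  ... | no X≢⊤ = begin
    𝟙 (isFlatᵇ M X)                                   ≡⟨ cong 𝟙 (sym below) ⟩
    𝟙 (isFlatᵇ M X ∧ (⌊ X ⊆? ⊤ ⌋ ∧ true))             ≡⟨ sym (ℤP.+-identityˡ _) ⟩
    0ℤ + 𝟙 (isFlatᵇ M X ∧ (⌊ X ⊆? ⊤ ⌋ ∧ true))        ∎
    where
    below : isFlatᵇ M X ∧ (⌊ X ⊆? ⊤ ⌋ ∧ true) ≡ isFlatᵇ M X
    below = trans (cong (λ b → isFlatᵇ M X ∧ (b ∧ true)) (Equivalence.to BoolP.T-≡ (fromWitness {a? = X ⊆? ⊤} ⊆⊤)))
                  (BoolP.∧-identityʳ (isFlatᵇ M X))

  χ-at-1 : 1 ≤ n → χ M (+ 1) ≡ 0ℤ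
  χ-at-1 1≤n = begin
    χ M (+ 1)
      ≡⟨ Σ-cong (flats M) (λ X _ → trans (cong (μ M X *_) (1^k (r ∸ rk M X))) (ℤP.*-identityʳ (μ M X))) ⟩
    Σℤ (map (μ M) (flats M))
      ≡⟨ Σ-filter (isFlatᵇ M) (μ M) (allSubsets n) ⟩
    ΣS (λ X → 𝟙 (isFlatᵇ M X) * μ M X)
      ≡⟨ Σ-cong (allSubsets n) (λ X _ → trans (cong (_* μ M X) (flat-split X))
                                              (ℤP.*-distribʳ-+ (μ M X) (𝟙 (isTopᵇ X)) _)) ⟩
    ΣS (λ X → 𝟙 (isTopᵇ X) * μ M X + 𝟙 (isFlatᵇ M X ∧ properSubᵇ M X ⊤) * μ M X)
      ≡⟨ Σ-+ (λ X → 𝟙 (isTopᵇ X) * μ M X) (λ X → 𝟙 (isFlatᵇ M X ∧ properSubᵇ M X ⊤) * μ M X) (allSubsets n) ⟩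
    ΣS (λ X → 𝟙 (isTopᵇ X) * μ M X) + ΣS (λ X → 𝟙 (isFlatᵇ M X ∧ properSubᵇ M X ⊤) * μ M X)
      ≡⟨ cong₂ _+_ (ΣS-unique isTopᵇ (μ M) ⊤ (λ X t → toWitness t) (fromWitness refl))
                   (sym (ℤP.neg-involutive _)) ⟩
    μ M ⊤ + - - ΣS (λ X → 𝟙 (isFlatᵇ M X ∧ properSubᵇ M X ⊤) * μ M X)
      ≡⟨ cong (λ m → μ M ⊤ + - m) (sym (μ-rec ⊤ ⊤≢∅)) ⟩
    μ M ⊤ + - μ M ⊤
      ≡⟨ ℤP.+-inverseʳ (μ M ⊤) ⟩
    0ℤ ∎
    where
    1^k : ∀ k → 1ℤ ^ k ≡ 1ℤ
    1^k zero    = refl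
    1^k (suc k) = trans (ℤP.*-identityˡ _) (1^k k)
    ⊤≢∅ : ¬ ⊤ ≡ ⊥
    ⊤≢∅ eq = ℕP.<-irrefl refl (ℕP.≤-trans 1≤n (ℕP.≤-reflexive
               (trans (sym (∣⊤∣≡n n)) (trans (cong ∣_∣ eq) (∣⊥∣≡0 n)))))

  -- Double counting: every pair of points lies on exactly one line, so
  -- Σ_{lines L} C(|L|, 2) = C(n, 2).
  pairs-on-lines : ΣS (λ L → 𝟙 (isLineᵇ L) * + (∣ L ∣ C 2)) ≡ + (n C 2)
  pairs-on-lines = begin
    ΣS (λ L → 𝟙 (isLineᵇ L) * + (∣ L ∣ C 2))
      ≡⟨ Σ-cong (allSubsets n) (λ L _ → cong (𝟙 (isLineᵇ L) *_) (sym (ΣS-⊆-size L 2))) ⟩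
    ΣS (λ L → 𝟙 (isLineᵇ L) * ΣS (λ Y → pair-in Y L))
      ≡⟨ Σ-cong (allSubsets n) (λ L _ → sym (Σ-scale (𝟙 (isLineᵇ L)) (λ Y → pair-in Y L) (allSubsets n))) ⟩
    ΣS (λ L → ΣS (λ Y → 𝟙 (isLineᵇ L) * pair-in Y L))
      ≡⟨ Σ-swap (λ L Y → 𝟙 (isLineᵇ L) * pair-in Y L) (allSubsets n) (allSubsets n) ⟩
    ΣS (λ Y → ΣS (λ L → 𝟙 (isLineᵇ L) * pair-in Y L))
      ≡⟨ Σ-cong (allSubsets n) (λ Y _ → lines-through Y) ⟩
    ΣS {n} (λ Y → 𝟙 (∣ Y ∣ ℕ.≡ᵇ 2))
      ≡⟨ ΣS-size n 2 ⟩
    + (n C 2) ∎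
    where
    pair-in : Subset n → Subset n → ℤ
    pair-in Y L = 𝟙 ((Y ⊆ᵇ L) ∧ (∣ Y ∣ ℕ.≡ᵇ 2))
    on-one-line : ∀ Y → ∣ Y ∣ ≡ 2 → ΣS (λ L → 𝟙 (isLineᵇ L ∧ (Y ⊆ᵇ L)) * 1ℤ) ≡ 1ℤ
    on-one-line Y pair with line-through Y pair
    ... | L , line , Y⊆L = ΣS-unique (λ X → isLineᵇ X ∧ (Y ⊆ᵇ X)) (λ _ → 1ℤ) L
      (λ X t → line-unique Y L X pair line Y⊆L (∧-fst t) (⊆ᵇ-sound Y X (∧-snd {isLineᵇ X} t)))
      (∧-intro line (⊆ᵇ-complete Y L Y⊆L))
    lines-through : ∀ Y → ΣS (λ L → 𝟙 (isLineᵇ L) * pair-in Y L) ≡ 𝟙 (∣ Y ∣ ℕ.≡ᵇ 2)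
    lines-through Y with ∣ Y ∣ ℕ.≡ᵇ 2 in size
    ... | false = Σ-zero _ (allSubsets n) (λ L → trans (cong (𝟙 (isLineᵇ L) *_) (𝟙-∧-false (Y ⊆ᵇ L)))
                                                       (ℤP.*-zeroʳ (𝟙 (isLineᵇ L))))
    ... | true  = trans (Σ-cong (allSubsets n) (λ L _ → begin
        𝟙 (isLineᵇ L) * 𝟙 ((Y ⊆ᵇ L) ∧ true)   ≡⟨ cong (λ b → 𝟙 (isLineᵇ L) * 𝟙 b) (BoolP.∧-identityʳ (Y ⊆ᵇ L)) ⟩
        𝟙 (isLineᵇ L) * 𝟙 (Y ⊆ᵇ L)            ≡⟨ sym (𝟙-∧ (isLineᵇ L) (Y ⊆ᵇ L)) ⟩
        𝟙 (isLineᵇ L ∧ (Y ⊆ᵇ L))              ≡⟨ sym (ℤP.*-identityʳ _) ⟩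
        𝟙 (isLineᵇ L ∧ (Y ⊆ᵇ L)) * 1ℤ         ∎))
      (on-one-line Y (ℕP.≡ᵇ⇒≡ _ _ (subst T (sym size) tt)))

open import Data.Fin.Subset using (Subset; ∣_∣)
open import Relation.Binary.PropositionalEquality using (_≡_)

module ShortLines {n : ℕ} (M : Matroid n) (simple : IsSimple M)
  (short : ∀ (X : Subset n) → IsFlat M X → rk M X ≡ 2 → ∣ X ∣ ℕ.≤ 3) where

  open import Data.Nat using (suc; _≤_; z≤n; s≤s; _∸_)
  import Data.Nat.Properties as ℕP
  open import Data.Integer using (ℤ; +_; -_; _+_; _*_; _-_; 1ℤ)
  import Data.Integer.Properties as ℤP
  open import Data.Bool using (true; false; _∧_; T)
  import Data.Bool.Properties as BoolP
  open import Function.Bundles using (Equivalence)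
  open import Data.List using (length)
  open import Data.Product using (_×_; _,_)
  open import Data.Nat.Combinatorics using (_C_)
  open import Data.Empty using (⊥-elim)
  open import Data.Unit using (tt)
  open import Relation.Nullary using (¬_)
  open import Relation.Binary.PropositionalEquality
  open ≡-Reasoning
  open Polynomial
  open Booleans
  open Subsets
  open FiniteSums
  open Flats M
  open SimpleMatroid M simple
  open Möbius M simple
  open CharPoly M simple

  -- A three-element circuit spans a line, which has no room for a fourth point.
  circuit⇒line : ∀ X → ∣ X ∣ ≡ 3 → T (isCircuitᵇ M X) → IsLine X
  circuit⇒line X size circuit with two-elements X (ℕP.≤-trans (s≤s (s≤s z≤n)) (ℕP.≤-reflexive (sym size)))
  ... | e , f , e∈X , f∈X , e≢f with closure X
  ...   | L , flat , X⊆L , rkL = subst IsLine (sym X≡L) (mk-line flat (trans rkL rk≡2))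
    where
    dependent : ¬ rk M X ≡ 3
    dependent eq = not-T (rk M X ℕ.≡ᵇ ∣ X ∣) (∧-fst circuit) (ℕP.≡⇒≡ᵇ _ _ (trans eq (sym size)))
    rk≡2 : rk M X ≡ 2
    rk≡2 with rk M X | ℕP.≤-trans (rk-card M X) (ℕP.≤-reflexive size) | rk≥2 e∈X f∈X e≢f | dependent
    ... | 2 | _ | _ | _ = refl
    ... | 3 | _ | _ | ≢3 = ⊥-elim (≢3 refl)
    ... | 0 | _ | () | _
    ... | 1 | _ | s≤s () | _
    ... | suc (suc (suc (suc _))) | s≤s (s≤s (s≤s ())) | _ | _
    X≡L : X ≡ L
    X≡L = ⊆-size-eq X L X⊆L (ℕP.≤-trans (short L flat (trans rkL rk≡2)) (ℕP.≤-reflexive (sym size)))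

  -- On a line with two or three points, μ(L) = |L| - 1 = C(|L|, 2) - [L is a 3-circuit].
  line-μ : ∀ X → 𝟙 (isLineᵇ X) * μ M X
         ≡ 𝟙 (isLineᵇ X) * + (∣ X ∣ C 2) + - 1ℤ * 𝟙 ((∣ X ∣ ℕ.≡ᵇ 3) ∧ isCircuitᵇ M X)
  line-μ X with isLineᵇ X in is-line
  ... | true = by-size ∣ X ∣ refl (line-size≥2 line) (short X (line-flat line) (line-rk line))
    where
    line : IsLine X
    line = subst T (sym is-line) tt
    by-size : ∀ c → ∣ X ∣ ≡ c → 2 ≤ c → c ≤ 3
            → 1ℤ * μ M X ≡ 1ℤ * + (∣ X ∣ C 2) + - 1ℤ * 𝟙 ((∣ X ∣ ℕ.≡ᵇ 3) ∧ isCircuitᵇ M X)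
    by-size 2 size _ _ = begin
      1ℤ * μ M X       ≡⟨ ℤP.*-identityˡ _ ⟩
      μ M X            ≡⟨ μ-line X line ⟩
      + ∣ X ∣ - 1ℤ     ≡⟨ cong (λ k → + k - 1ℤ) size ⟩
      1ℤ               ≡⟨ cong (λ k → 1ℤ * + (k C 2) + - 1ℤ * 𝟙 ((k ℕ.≡ᵇ 3) ∧ isCircuitᵇ M X)) (sym size) ⟩
      1ℤ * + (∣ X ∣ C 2) + - 1ℤ * 𝟙 ((∣ X ∣ ℕ.≡ᵇ 3) ∧ isCircuitᵇ M X) ∎
    by-size 3 size _ _ = begin
      1ℤ * μ M X       ≡⟨ ℤP.*-identityˡ _ ⟩
      μ M X            ≡⟨ μ-line X line ⟩
      + ∣ X ∣ - 1ℤ     ≡⟨ cong (λ k → + k - 1ℤ) size ⟩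
      + 2              ≡⟨ cong (λ b → + 3 + - 1ℤ * 𝟙 b) (sym circuit) ⟩
      + 3 + - 1ℤ * 𝟙 (isCircuitᵇ M X)
                       ≡⟨ cong (λ k → 1ℤ * + (k C 2) + - 1ℤ * 𝟙 ((k ℕ.≡ᵇ 3) ∧ isCircuitᵇ M X)) (sym size) ⟩
      1ℤ * + (∣ X ∣ C 2) + - 1ℤ * 𝟙 ((∣ X ∣ ℕ.≡ᵇ 3) ∧ isCircuitᵇ M X) ∎
      where
      circuit : isCircuitᵇ M X ≡ true
      circuit = Equivalence.to BoolP.T-≡ (line⇒circuit X size line)
    by-size (suc (suc (suc (suc c)))) _ _ (s≤s (s≤s (s≤s ())))
    by-size 0 _ () _
    by-size 1 _ (s≤s ()) _
  ... | false with (∣ X ∣ ℕ.≡ᵇ 3) ∧ isCircuitᵇ M X in three-circuit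
  ...   | false = refl
  ...   | true  = ⊥-elim (subst T is-line (circuit⇒line X (ℕP.≡ᵇ⇒≡ _ _ (∧-fst t)) (∧-snd {∣ X ∣ ℕ.≡ᵇ 3} t)))
    where
    t = subst T (sym three-circuit) tt

  t : ℕ
  t = numThreeCircuits M

  three-circuits : + t ≡ ΣS (λ X → 𝟙 ((∣ X ∣ ℕ.≡ᵇ 3) ∧ isCircuitᵇ M X))
  three-circuits = length-filter (λ C → (∣ C ∣ ℕ.≡ᵇ 3) ∧ isCircuitᵇ M C) (allSubsets n)

  coeff-second : 2 ≤ r → coeff χ-poly (r ∸ 2) ≡ + (n C 2) - + t
  coeff-second 2≤r = begin
    coeff χ-poly (r ∸ 2)
      ≡⟨ coeff-rank 2 2≤r ⟩
    ΣS (λ X → 𝟙 (isLineᵇ X) * μ M X)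
      ≡⟨ Σ-cong (allSubsets n) (λ X _ → line-μ X) ⟩
    ΣS (λ X → 𝟙 (isLineᵇ X) * + (∣ X ∣ C 2) + - 1ℤ * circuit3 X)
      ≡⟨ Σ-+ (λ X → 𝟙 (isLineᵇ X) * + (∣ X ∣ C 2)) (λ X → - 1ℤ * circuit3 X) (allSubsets n) ⟩
    ΣS (λ X → 𝟙 (isLineᵇ X) * + (∣ X ∣ C 2)) + ΣS (λ X → - 1ℤ * circuit3 X)
      ≡⟨ cong₂ _+_ pairs-on-lines (Σ-scale (- 1ℤ) circuit3 (allSubsets n)) ⟩
    + (n C 2) + - 1ℤ * ΣS circuit3
      ≡⟨ cong (λ u → + (n C 2) + u) (trans (ℤP.-1*i≡-i _) (cong -_ (sym three-circuits))) ⟩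
    + (n C 2) - + t ∎
    where
    circuit3 : Subset n → ℤ
    circuit3 X = 𝟙 ((∣ X ∣ ℕ.≡ᵇ 3) ∧ isCircuitᵇ M X)

  χ-roots : 2 ≤ r → ∀ as → (∀ x → χ M x ≡ prodLin as x)
          → length as ≡ r × Σℤ as ≡ + n × e₂ as ≡ + (n C 2) - + t
  χ-roots 2≤r as χ≡ with vieta χ-poly r as 2≤r χ-monic (λ x → trans (sym (eval-χ-poly x)) (χ≡ x))
  ... | length≡r , e₁-coeff , e₂-coeff =
        length≡r
      , ℤP.neg-injective (trans (sym e₁-coeff) (coeff-below-leading (ℕP.≤-trans (s≤s z≤n) 2≤r)))
      , trans (sym e₂-coeff) (coeff-second 2≤r)

open import Data.Nat using (ℕ; _+_; _*_; _∸_; _≤_)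
open import Data.Integer as ℤ using (ℤ; +_)
open import Data.List using (List)
open import Data.Fin.Subset using (Subset; ∣_∣)
open import Data.Product using (_×_; ∃)
open import Function.Bundles using (_⇔_)
open import Relation.Binary.PropositionalEquality using (_≡_; refl)
import Data.Nat.Properties as ℕP

lemma4p2 : (n r δ : ℕ) (M : Matroid n) → IsSimple M → rank M ≡ r
  → n + δ + 3 ≡ 3 * r → δ + 2 ≤ r
  → (∀ (X : Subset n) → IsFlat M X → rk M X ≡ 2 → ∣ X ∣ ≤ 3)
  → ∃ (λ (as : List ℤ) → ∀ x → χ M x ≡ prodLin as x)
  → χ M (+ 2) ≡ + 0
  → (3 * r ∸ (5 + 2 * δ) ≤ numThreeCircuits M)
    × (numThreeCircuits M ≡ 3 * r ∸ (5 + 2 * δ)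
       ⇔ (∀ x → χ M x ≡ (x ℤ.- + 1) ℤ.* ((x ℤ.- + 2) ℤ.^ (δ + 1)) ℤ.* ((x ℤ.- + 3) ℤ.^ (r ∸ 2 ∸ δ))))
-- Substituting r = rank M: the matroid supplies the coefficients of χ (via
-- Vieta) and the root χ(1) = 0, and the root count does the rest.
lemma4p2 n _ δ M simple refl n+δ+3≡3r δ+2≤r short factorization χ[2]≡0 =
  root-count n (rank M) δ (numThreeCircuits M) (χ M) n+δ+3≡3r δ+2≤r
    (χ-roots 2≤r) χ[1]≡0 factorization χ[2]≡0
  where
  open RootArithmetic using (root-count; ground-nonempty)
  open CharPoly M simple using (χ-at-1)
  open ShortLines M simple short using (χ-roots)
  2≤r : 2 ≤ rank M
  2≤r = ℕP.≤-trans (ℕP.m≤n+m 2 δ) δ+2≤r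
  χ[1]≡0 : χ M (+ 1) ≡ + 0
  χ[1]≡0 = χ-at-1 (ground-nonempty n (rank M) δ n+δ+3≡3r δ+2≤r)
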